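{- Let $m$ be a positive integer and $a,b$ complex numbers. Let $f_m(z,a,b)=\sum_{n\ge0}c(n,m,a,b)z^n$ be the unique formal power series with $f_m=1+azf_m+bz^mf_m^2$, and let $g(n,m,a,b)$ be defined by $\sum_{n\ge0}g(n,m,a,b)z^n=\frac{1}{\sqrt{(1-az)^2-4bz^m}}$. Put $d_k^{(m)}(N,a,b)=\det\big(c(i+j+k,m,a,b)\big)_{i,j=0}^{N-1}$ and $dd_k^{(m)}(N,a,b)=\det\big(g(i+j+k,m,a,b)\big)_{i,j=0}^{N-1}$. Then for every integer $n\ge0$: $d_0^{(m)}(mn+k,a,b)=0$ for $2\le k\le m-1$; $d_1^{(m)}(mn+k,a,b)=0$ for $2\le k\le m-2$; $d_2^{(m)}(mn+k,a,b)=0$ for $2\le k\le m-3$. The same vanishing statements hold with $d_j^{(m)}$ replaced by $dd_j^{(m)}$ ($j=0,1,2$).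
   Context: The power series $\frac{1}{\sqrt{(1-az)^2-4bz^m}}$ is the formal power series with constant term $1$. -}

module Defs where

open import Level using (Level)
open import Data.Nat using (ℕ; zero; suc; _∸_)
import Data.Nat
open import Data.Fin using (Fin; zero; suc; toℕ; punchIn)
open import Algebra.Bundles using (CommutativeRing)

module PS {c ℓ : Level} (R : CommutativeRing c ℓ) where
  open CommutativeRing R public using (Carrier; _≈_; _+_; _*_; -_; 0#; 1#)

  Series : Set c
  Series = ℕ → Carrier

  sumℕ : ℕ → (ℕ → Carrier) → Carrier
  sumℕ zero    h = 0#
  sumℕ (suc n) h = sumℕ n h + h n

  one : Series
  one zero    = 1#
  one (suc _) = 0#

  conv : Series → Series → Series
  conv f g n = sumℕ (suc n) (λ i → f i * g (n ∸ i))

  shift : ℕ → Series → Series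
  shift zero    f n       = f n
  shift (suc k) f zero    = 0#
  shift (suc k) f (suc n) = shift k f n

  scale : Carrier → Series → Series
  scale a f n = a * f n

  IsF : ℕ → Carrier → Carrier → Series → Set ℓ
  IsF m a b f = ∀ n → f n ≈ (one n + scale a (shift 1 f) n) + scale b (shift m (conv f f)) n

  oneMinusAz : Carrier → Series
  oneMinusAz a zero          = 1#
  oneMinusAz a (suc zero)    = - a
  oneMinusAz a (suc (suc _)) = 0#

  P : ℕ → Carrier → Carrier → Series
  P m a b n = conv (oneMinusAz a) (oneMinusAz a) n
              + - (((b + b) + b) + b) * shift m one n

  -- g = 1/sqrt(P): the series with constant term 1 and g^2 * P = 1
  IsG : ℕ → Carrier → Carrier → Series → Set ℓ
  IsG m a b g = (g 0 ≈ 1#) × (∀ n → conv (conv g g) (P m a b) n ≈ one n)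
    where open import Data.Product using (_×_)

  alt : ℕ → Carrier → Carrier
  alt zero    x = x
  alt (suc k) x = - alt k x

  sumFin : ∀ {n} → (Fin n → Carrier) → Carrier
  sumFin {zero}  h = 0#
  sumFin {suc n} h = h zero + sumFin (λ i → h (suc i))

  det : ∀ {n} → (Fin n → Fin n → Carrier) → Carrier
  det {zero}  M = 1#
  det {suc n} M = sumFin (λ j → alt (toℕ j) (M zero j * det (λ i k → M (suc i) (punchIn j k))))

  hankel : Series → ℕ → (N : ℕ) → Fin N → Fin N → Carrier
  hankel s k N i j = s ((toℕ i Data.Nat.+ toℕ j) Data.Nat.+ k)

module Submission where

-- Write W = 1 - az, β = b z^m and Y = W f - 1.  The equation
-- f = 1 + az f + β f² says Y = β f², hence Y satisfies the quadratic equation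
-- τ Y = β (Y² + 1) with τ = W² - 2β.  The convergents of the resulting
-- continued fraction, A n and B n (polynomials of degree ≤ mn obtained from the
-- recurrence X (n+2) = τ X (n+1) - β² X n), satisfy A n · Y = B n + (βY)^n · Y,
-- whose error term has order ≥ 2mn + m.  Consequently Q = W · A n, a polynomial
-- of degree ≤ mn + 1 with Q 0 = 1, kills the coefficients of f·Q in the degrees
-- mn + 1 ≤ t < 2mn + m.  Likewise g (1 - Y) = f (here 2 must not be a zero
-- divisor), and W · (A n - B n) plays the same role for g.  Finally, a
-- polynomial with this property yields the kernel vector (Q D, ..., Q 0, 0, ...)
-- of every Hankel matrix whose rows fit into that window, so its determinant
-- vanishes.

open import Defs
open import Level using (Level)
open import Data.Nat using (ℕ; zero; suc; _<_; _≤_; z≤n; s≤s)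
import Data.Nat as N
import Data.Nat.Properties as NP
open import Data.Integer as ℤ using (ℤ; +_; -[1+_])
import Data.Integer.Properties as ℤP
open import Data.Fin using (Fin; toℕ; punchIn) renaming (zero to fz; suc to fs)
open import Data.Maybe using (Maybe; just; nothing)
open import Data.Product using (_×_; _,_; proj₁; proj₂)
open import Data.Sum using (_⊎_; inj₁; inj₂)
open import Data.Empty using (⊥-elim)
open import Relation.Nullary using (Dec; yes; no)
open import Relation.Binary.Definitions using (tri<; tri≈; tri>)
open import Relation.Binary.PropositionalEquality as P using (_≡_; _≢_)
open import Algebra.Bundles using (CommutativeRing)
open import Algebra.Structures using (IsCommutativeRing)
import Algebra.Solver.Ring.AlmostCommutativeRing as ACR

-- For an arbitrary
-- commutative ring we use integer coefficients, interpreted by the unique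
-- ring homomorphism ℤ → R.
module IntegerSolver {c ℓ : Level} (R : CommutativeRing c ℓ) where
  open CommutativeRing R
  open import Algebra.Properties.Ring ring using (-‿involutive; -0#≈0#; -‿+-comm; -‿distribˡ-*; -‿distribʳ-*)
  open import Algebra.Properties.Semiring.Mult.TCOptimised semiring using (1+×; ×-homo-+; ×1-homo-*)
    renaming (_×_ to _·_)
  open import Relation.Binary.Reasoning.Setoid setoid

  -- the image of an integer in R; 1 is sent to 1# on the nose, so that the
  -- solver's constant 1 is definitionally the unit of R
  ι : ℤ → Carrier
  ι (+ n)      = n · 1#
  ι -[1+ n ]   = - (suc n · 1#)

  ι-neg : ∀ i → ι (ℤ.- i) ≈ - ι i
  ι-neg (+ zero)   = sym -0#≈0#
  ι-neg (+ suc n)  = refl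
  ι-neg -[1+ n ]   = sym (-‿involutive _)

  cancel-one : ∀ x y → (1# + x) + - (1# + y) ≈ x + - y
  cancel-one x y = begin
    (1# + x) + - (1# + y)       ≈⟨ +-congˡ (sym (-‿+-comm 1# y)) ⟩
    (1# + x) + (- 1# + - y)     ≈⟨ +-assoc 1# x _ ⟩
    1# + (x + (- 1# + - y))     ≈⟨ +-congˡ (trans (sym (+-assoc x _ _)) (+-congʳ (+-comm x _))) ⟩
    1# + ((- 1# + x) + - y)     ≈⟨ +-congˡ (+-assoc _ x _) ⟩
    1# + (- 1# + (x + - y))     ≈⟨ sym (+-assoc 1# _ _) ⟩
    (1# + - 1#) + (x + - y)     ≈⟨ +-congʳ (-‿inverseʳ 1#) ⟩
    0# + (x + - y)              ≈⟨ +-identityˡ _ ⟩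
    x + - y                     ∎

  ι-⊖ : ∀ m n → ι (m ℤ.⊖ n) ≈ m · 1# + - (n · 1#)
  ι-⊖ m       zero    = sym (trans (+-congˡ -0#≈0#) (+-identityʳ _))
  ι-⊖ zero    (suc n) = sym (+-identityˡ _)
  ι-⊖ (suc m) (suc n) = begin
    ι (suc m ℤ.⊖ suc n)           ≡⟨ P.cong ι (ℤP.[1+m]⊖[1+n]≡m⊖n m n) ⟩
    ι (m ℤ.⊖ n)                   ≈⟨ ι-⊖ m n ⟩
    m · 1# + - (n · 1#)           ≈⟨ sym (cancel-one _ _) ⟩
    (1# + m · 1#) + - (1# + n · 1#) ≈⟨ sym (+-cong (1+× m 1#) (-‿cong (1+× n 1#))) ⟩
    suc m · 1# + - (suc n · 1#)   ∎

  ι-+ : ∀ i j → ι (i ℤ.+ j) ≈ ι i + ι j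
  ι-+ (+ m)    (+ n)    = ×-homo-+ 1# m n
  ι-+ (+ m)    -[1+ n ] = ι-⊖ m (suc n)
  ι-+ -[1+ m ] (+ n)    = trans (ι-⊖ n (suc m)) (+-comm _ _)
  ι-+ -[1+ m ] -[1+ n ] = begin
    - (suc (suc (m N.+ n)) · 1#)         ≡⟨ P.cong (λ k → - (suc k · 1#)) (P.sym (NP.+-suc m n)) ⟩
    - ((suc m N.+ suc n) · 1#)           ≈⟨ -‿cong (×-homo-+ 1# (suc m) (suc n)) ⟩
    - (suc m · 1# + suc n · 1#)          ≈⟨ sym (-‿+-comm _ _) ⟩
    - (suc m · 1#) + - (suc n · 1#)      ∎

  ι-*⁺ : ∀ m j → ι (+ m ℤ.* j) ≈ (m · 1#) * ι j
  ι-*⁺ m (+ n)      = trans (reflexive (P.cong ι (P.sym (ℤP.pos-* m n)))) (×1-homo-* m n)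
  ι-*⁺ m -[1+ n ]   = begin
    ι (+ m ℤ.* -[1+ n ])           ≡⟨ P.cong ι (P.sym (ℤP.neg-distribʳ-* (+ m) (+ suc n))) ⟩
    ι (ℤ.- (+ m ℤ.* + suc n))      ≈⟨ ι-neg (+ m ℤ.* + suc n) ⟩
    - ι (+ m ℤ.* + suc n)          ≈⟨ -‿cong (ι-*⁺ m (+ suc n)) ⟩
    - ((m · 1#) * (suc n · 1#))    ≈⟨ -‿distribʳ-* _ _ ⟩
    (m · 1#) * ι -[1+ n ]          ∎

  ι-* : ∀ i j → ι (i ℤ.* j) ≈ ι i * ι j
  ι-* (+ m)    j = ι-*⁺ m j
  ι-* -[1+ m ] j = begin
    ι (-[1+ m ] ℤ.* j)             ≡⟨ P.cong ι (P.sym (ℤP.neg-distribˡ-* (+ suc m) j)) ⟩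
    ι (ℤ.- (+ suc m ℤ.* j))        ≈⟨ ι-neg (+ suc m ℤ.* j) ⟩
    - ι (+ suc m ℤ.* j)            ≈⟨ -‿cong (ι-*⁺ (suc m) j) ⟩
    - ((suc m · 1#) * ι j)         ≈⟨ -‿distribˡ-* _ _ ⟩
    ι -[1+ m ] * ι j               ∎

  ι-homomorphism : CommutativeRing.rawRing ℤP.+-*-commutativeRing ACR.-Raw-AlmostCommutative⟶ ACR.fromCommutativeRing R
  ι-homomorphism = record
    { ⟦_⟧ = ι ; +-homo = ι-+ ; *-homo = ι-* ; -‿homo = ι-neg
    ; 0-homo = refl ; 1-homo = refl }

  ι-test : ∀ i j → Maybe (ι i ≈ ι j)
  ι-test i j with i ℤ.≟ j
  ... | yes P.refl = just refl
  ... | no _       = nothing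

  open import Algebra.Solver.Ring (CommutativeRing.rawRing ℤP.+-*-commutativeRing)
    (ACR.fromCommutativeRing R) ι-homomorphism ι-test public

-- Column bookkeeping for minors.  punchIn′ j k is the k-th element of ℕ ∖ {j}
-- (the ℕ-version of Data.Fin.punchIn), and punchOut′ j is its inverse on ℕ ∖ {j};
-- column k of the minor without column j is column punchIn′ j k of the matrix.
punchIn′ : ℕ → ℕ → ℕ
punchIn′ zero    k       = suc k
punchIn′ (suc j) zero    = zero
punchIn′ (suc j) (suc k) = suc (punchIn′ j k)

punchOut′ : ℕ → ℕ → ℕ
punchOut′ zero    zero    = zero
punchOut′ zero    (suc c) = c
punchOut′ (suc j) zero    = zero
punchOut′ (suc j) (suc c) = suc (punchOut′ j c)

toℕ-punchIn : ∀ {n} (j : Fin (suc n)) (k : Fin n) → toℕ (punchIn j k) ≡ punchIn′ (toℕ j) (toℕ k)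
toℕ-punchIn fz     k      = P.refl
toℕ-punchIn (fs j) fz     = P.refl
toℕ-punchIn (fs j) (fs k) = P.cong suc (toℕ-punchIn j k)

punchIn′-punchOut′ : ∀ j c → j ≢ c → punchIn′ j (punchOut′ j c) ≡ c
punchIn′-punchOut′ zero    zero    j≢c = ⊥-elim (j≢c P.refl)
punchIn′-punchOut′ zero    (suc c) j≢c = P.refl
punchIn′-punchOut′ (suc j) zero    j≢c = P.refl
punchIn′-punchOut′ (suc j) (suc c) j≢c = P.cong suc (punchIn′-punchOut′ j c (λ e → j≢c (P.cong suc e)))

punchOut′-punchIn′ : ∀ j k → punchOut′ j (punchIn′ j k) ≡ k
punchOut′-punchIn′ zero    k       = P.refl
punchOut′-punchIn′ (suc j) zero    = P.refl
punchOut′-punchIn′ (suc j) (suc k) = P.cong suc (punchOut′-punchIn′ j k)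

punchIn′ᵢ≢i : ∀ j k → punchIn′ j k ≢ j
punchIn′ᵢ≢i (suc j) zero    ()
punchIn′ᵢ≢i (suc j) (suc k) e = punchIn′ᵢ≢i j k (NP.suc-injective e)

punchIn′-≤ : ∀ j k → punchIn′ j k ≤ suc k
punchIn′-≤ zero    k       = NP.≤-refl
punchIn′-≤ (suc j) zero    = z≤n
punchIn′-≤ (suc j) (suc k) = s≤s (punchIn′-≤ j k)

punchOut′-< : ∀ n j c → j < suc n → c < suc n → j ≢ c → punchOut′ j c < n
punchOut′-< n       zero    zero    _        _        j≢c = ⊥-elim (j≢c P.refl)
punchOut′-< n       zero    (suc c) _        (s≤s c<) _   = c<
punchOut′-< zero    (suc j) c       (s≤s ()) _        _
punchOut′-< (suc n) (suc j) zero    _        _        _   = s≤s z≤n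
punchOut′-< (suc n) (suc j) (suc c) (s≤s j<) (s≤s c<) j≢c =
  s≤s (punchOut′-< n j c j< c< (λ e → j≢c (P.cong suc e)))

-- deleting column p or column p+1 selects the same columns, except that
-- position p refers to column p+1 in the first case and to column p in the second
punchIn′-adjacent : ∀ p k → punchIn′ p k ≡ punchIn′ (suc p) k ⊎ k ≡ p
punchIn′-adjacent zero    zero    = inj₂ P.refl
punchIn′-adjacent zero    (suc k) = inj₁ P.refl
punchIn′-adjacent (suc p) zero    = inj₁ P.refl
punchIn′-adjacent (suc p) (suc k) with punchIn′-adjacent p k
... | inj₁ e = inj₁ (P.cong suc e)
... | inj₂ e = inj₂ (P.cong suc e)

punchIn′-self : ∀ p → punchIn′ p p ≡ suc p
punchIn′-self zero    = P.refl
punchIn′-self (suc p) = P.cong suc (punchIn′-self p)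

punchIn′-suc-self : ∀ p → punchIn′ (suc p) p ≡ p
punchIn′-suc-self zero    = P.refl
punchIn′-suc-self (suc p) = P.cong suc (punchIn′-suc-self p)

punchOut′-suc : ∀ j p → j ≢ p → j ≢ suc p → punchOut′ j (suc p) ≡ suc (punchOut′ j p)
punchOut′-suc zero          zero    j≢p _     = ⊥-elim (j≢p P.refl)
punchOut′-suc zero          (suc p) _   _     = P.refl
punchOut′-suc (suc zero)    zero    _   j≢sp  = ⊥-elim (j≢sp P.refl)
punchOut′-suc (suc (suc j)) zero    _   _     = P.refl
punchOut′-suc (suc j)       (suc p) j≢p j≢sp  =
  P.cong suc (punchOut′-suc j p (λ e → j≢p (P.cong suc e)) (λ e → j≢sp (P.cong suc e)))

module FiniteSums {c ℓ : Level} (R : CommutativeRing c ℓ) where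
  open CommutativeRing R
  open PS R using (sumℕ)
  open IntegerSolver R using (solve; _:=_; _:+_; _:*_)
  open import Relation.Binary.Reasoning.Setoid setoid

  sum-cong : ∀ n {f g : ℕ → Carrier} → (∀ j → j < n → f j ≈ g j) → sumℕ n f ≈ sumℕ n g
  sum-cong zero    f≈g = refl
  sum-cong (suc n) f≈g = +-cong (sum-cong n (λ j j< → f≈g j (NP.m<n⇒m<1+n j<))) (f≈g n NP.≤-refl)

  sum-zero : ∀ n (f : ℕ → Carrier) → (∀ j → j < n → f j ≈ 0#) → sumℕ n f ≈ 0#
  sum-zero zero    f f≈0 = refl
  sum-zero (suc n) f f≈0 =
    trans (+-cong (sum-zero n f (λ j j< → f≈0 j (NP.m<n⇒m<1+n j<))) (f≈0 n NP.≤-refl)) (+-identityˡ 0#)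

  sum-linear : ∀ n s t (f g : ℕ → Carrier) → sumℕ n (λ j → s * f j + t * g j) ≈ s * sumℕ n f + t * sumℕ n g
  sum-linear zero    s t f g = sym (trans (+-cong (zeroʳ s) (zeroʳ t)) (+-identityˡ 0#))
  sum-linear (suc n) s t f g = begin
    sumℕ n (λ j → s * f j + t * g j) + (s * f n + t * g n)
      ≈⟨ +-congʳ (sum-linear n s t f g) ⟩
    (s * sumℕ n f + t * sumℕ n g) + (s * f n + t * g n)
      ≈⟨ solve 6 (λ s t F G x y → (s :* F :+ t :* G) :+ (s :* x :+ t :* y) := s :* (F :+ x) :+ t :* (G :+ y))
               refl s t (sumℕ n f) (sumℕ n g) (f n) (g n) ⟩
    s * (sumℕ n f + f n) + t * (sumℕ n g + g n) ∎

  sum-split : ∀ a b (f : ℕ → Carrier) → sumℕ (a N.+ b) f ≈ sumℕ a f + sumℕ b (λ j → f (a N.+ j))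
  sum-split a zero    f = trans (reflexive (P.cong (λ x → sumℕ x f) (NP.+-identityʳ a))) (sym (+-identityʳ _))
  sum-split a (suc b) f = begin
    sumℕ (a N.+ suc b) f                                ≡⟨ P.cong (λ x → sumℕ x f) (NP.+-suc a b) ⟩
    sumℕ (a N.+ b) f + f (a N.+ b)                      ≈⟨ +-congʳ (sum-split a b f) ⟩
    (sumℕ a f + sumℕ b (λ j → f (a N.+ j))) + f (a N.+ b) ≈⟨ +-assoc _ _ _ ⟩
    sumℕ a f + sumℕ (suc b) (λ j → f (a N.+ j))         ∎

  sum-peel : ∀ n (f : ℕ → Carrier) → sumℕ (suc n) f ≈ f 0 + sumℕ n (λ j → f (suc j))
  sum-peel n f = trans (sum-split 1 n f) (+-congʳ (+-identityˡ (f 0)))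

  sum-single : ∀ n (f : ℕ → Carrier) p → p < n → (∀ j → j < n → j ≢ p → f j ≈ 0#) → sumℕ n f ≈ f p
  sum-single (suc n) f p p< f≈0 with p N.≟ n
  ... | yes P.refl = trans (+-congʳ (sum-zero n f (λ j j< → f≈0 j (NP.m<n⇒m<1+n j<) (λ e → NP.<-irrefl e j<))))
                           (+-identityˡ _)
  ... | no p≢n = trans (+-cong (sum-single n f p (NP.≤∧≢⇒< (NP.≤-pred p<) p≢n) (λ j j< → f≈0 j (NP.m<n⇒m<1+n j<)))
                               (f≈0 n NP.≤-refl (λ e → p≢n (P.sym e))))
                       (+-identityʳ _)

  sum-pair : ∀ n (f : ℕ → Carrier) p q → p < q → q < n → (∀ j → j < n → j ≢ p → j ≢ q → f j ≈ 0#) →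
             sumℕ n f ≈ f p + f q
  sum-pair (suc n) f p q p<q q< f≈0 with q N.≟ n
  ... | yes P.refl = +-congʳ (sum-single n f p p<q (λ j j< j≢p → f≈0 j (NP.m<n⇒m<1+n j<) j≢p (λ e → NP.<-irrefl e j<)))
  ... | no q≢n = trans (+-cong (sum-pair n f p q p<q q<n (λ j j< → f≈0 j (NP.m<n⇒m<1+n j<)))
                               (f≈0 n NP.≤-refl (λ e → NP.<-irrefl (P.sym e) (NP.<-trans p<q q<n)) (λ e → q≢n (P.sym e))))
                       (+-identityʳ _)
    where
    q<n : q < n
    q<n = NP.≤∧≢⇒< (NP.≤-pred q<) q≢n

-- The product is
-- defined by recursion on the first factor, which makes the ring laws easy to
-- prove by induction; it agrees with the Cauchy product conv of Defs.
module PowerSeries {c ℓ : Level} (R : CommutativeRing c ℓ) where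
  open CommutativeRing R hiding (zero)
  open PS R using (Series; one; conv; shift)
  open IntegerSolver R using (solve; _:=_; _:+_; _:*_)
  open FiniteSums R using (sum-peel)
  open import Algebra.Properties.Ring ring using (-0#≈0#)
  open import Relation.Binary.Reasoning.Setoid setoid

  infix  4 _≋_
  infixl 6 _⊕_
  infixl 7 _⊗_

  _≋_ : Series → Series → Set ℓ
  f ≋ g = ∀ n → f n ≈ g n

  _⊕_ : Series → Series → Series
  (f ⊕ g) n = f n + g n

  ⊝_ : Series → Series
  (⊝ f) n = - f n

  𝟘 : Series
  𝟘 n = 0#

  tail : Series → Series
  tail f n = f (suc n)

  const : Carrier → Series
  const x zero    = x
  const x (suc n) = 0#

  _⊗_ : Series → Series → Series
  (f ⊗ g) zero    = f 0 * g 0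
  (f ⊗ g) (suc n) = f 0 * g (suc n) + (tail f ⊗ g) n

  ⊗-cong : ∀ {f f′ g g′} → f ≋ f′ → g ≋ g′ → f ⊗ g ≋ f′ ⊗ g′
  ⊗-cong f≋f′ g≋g′ zero    = *-cong (f≋f′ 0) (g≋g′ 0)
  ⊗-cong f≋f′ g≋g′ (suc n) = +-cong (*-cong (f≋f′ 0) (g≋g′ (suc n))) (⊗-cong (λ k → f≋f′ (suc k)) g≋g′ n)

  ⊗-zeroˡ : ∀ f g → f ≋ 𝟘 → f ⊗ g ≋ 𝟘
  ⊗-zeroˡ f g f≋0 zero    = trans (*-congʳ (f≋0 0)) (zeroˡ _)
  ⊗-zeroˡ f g f≋0 (suc n) = trans (+-cong (trans (*-congʳ (f≋0 0)) (zeroˡ _)) (⊗-zeroˡ (tail f) g (λ k → f≋0 (suc k)) n))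
                                  (+-identityˡ 0#)

  ⊗-identityˡ : ∀ f → one ⊗ f ≋ f
  ⊗-identityˡ f zero    = *-identityˡ _
  ⊗-identityˡ f (suc n) = trans (+-cong (*-identityˡ _) (⊗-zeroˡ (tail one) f (λ _ → refl) n)) (+-identityʳ _)

  ⊗-constˡ : ∀ x f → const x ⊗ f ≋ λ n → x * f n
  ⊗-constˡ x f zero    = refl
  ⊗-constˡ x f (suc n) = trans (+-congˡ (⊗-zeroˡ (tail (const x)) f (λ _ → refl) n)) (+-identityʳ _)

  ⊗-distribʳ : ∀ f g h → (f ⊕ g) ⊗ h ≋ f ⊗ h ⊕ g ⊗ h
  ⊗-distribʳ f g h zero    = distribʳ _ _ _
  ⊗-distribʳ f g h (suc n) = trans (+-cong (distribʳ _ _ _) (⊗-distribʳ (tail f) (tail g) h n))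
    (solve 4 (λ a b c d → (a :+ b) :+ (c :+ d) := (a :+ c) :+ (b :+ d)) refl _ _ _ _)

  ⊗-distribˡ : ∀ f g h → f ⊗ (g ⊕ h) ≋ f ⊗ g ⊕ f ⊗ h
  ⊗-distribˡ f g h zero    = distribˡ _ _ _
  ⊗-distribˡ f g h (suc n) = trans (+-cong (distribˡ _ _ _) (⊗-distribˡ (tail f) g h n))
    (solve 4 (λ a b c d → (a :+ b) :+ (c :+ d) := (a :+ c) :+ (b :+ d)) refl _ _ _ _)

  ⊗-scaleˡ : ∀ x f g → (λ n → x * f n) ⊗ g ≋ λ n → x * (f ⊗ g) n
  ⊗-scaleˡ x f g zero    = *-assoc _ _ _
  ⊗-scaleˡ x f g (suc n) = trans (+-cong (*-assoc _ _ _) (⊗-scaleˡ x (tail f) g n)) (sym (distribˡ _ _ _))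

  ⊗-assoc : ∀ f g h → (f ⊗ g) ⊗ h ≋ f ⊗ (g ⊗ h)
  ⊗-assoc f g h zero    = *-assoc _ _ _
  ⊗-assoc f g h (suc n) = begin
    (f 0 * g 0) * h (suc n) + ((f0·tail-g ⊕ tail f ⊗ g) ⊗ h) n
      ≈⟨ +-congˡ (⊗-distribʳ f0·tail-g (tail f ⊗ g) h n) ⟩
    (f 0 * g 0) * h (suc n) + ((f0·tail-g ⊗ h) n + ((tail f ⊗ g) ⊗ h) n)
      ≈⟨ +-congˡ (+-cong (⊗-scaleˡ (f 0) (tail g) h n) (⊗-assoc (tail f) g h n)) ⟩
    (f 0 * g 0) * h (suc n) + (f 0 * (tail g ⊗ h) n + (tail f ⊗ (g ⊗ h)) n)
      ≈⟨ solve 5 (λ a b c d e → (a :* b) :* c :+ (a :* d :+ e) := a :* (b :* c :+ d) :+ e) refl (f 0) (g 0) (h (suc n)) _ _ ⟩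
    f 0 * (g ⊗ h) (suc n) + (tail f ⊗ (g ⊗ h)) n ∎
    where
    f0·tail-g : Series
    f0·tail-g k = f 0 * tail g k

  ⊗-comm : ∀ f g → f ⊗ g ≋ g ⊗ f
  ⊗-comm f g zero          = *-comm _ _
  ⊗-comm f g (suc zero)    = solve 4 (λ a b c d → a :* b :+ c :* d := d :* c :+ b :* a) refl (f 0) (g 1) (f 1) (g 0)
  ⊗-comm f g (suc (suc n)) = begin
    f 0 * g (2 N.+ n) + (tail f ⊗ g) (suc n)                          ≈⟨ +-congˡ (⊗-comm (tail f) g (suc n)) ⟩
    f 0 * g (2 N.+ n) + (g 0 * f (2 N.+ n) + (tail g ⊗ tail f) n)     ≈⟨ +-congˡ (+-congˡ (⊗-comm (tail g) (tail f) n)) ⟩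
    f 0 * g (2 N.+ n) + (g 0 * f (2 N.+ n) + (tail f ⊗ tail g) n)
      ≈⟨ solve 5 (λ a b c d e → a :* b :+ (c :* d :+ e) := c :* d :+ (a :* b :+ e)) refl (f 0) _ (g 0) _ _ ⟩
    g 0 * f (2 N.+ n) + (f 0 * g (2 N.+ n) + (tail f ⊗ tail g) n)     ≈⟨ +-congˡ (sym (⊗-comm (tail g) f (suc n))) ⟩
    g 0 * f (2 N.+ n) + (tail g ⊗ f) (suc n)                          ∎

  series-isCommutativeRing : IsCommutativeRing _≋_ _⊕_ _⊗_ ⊝_ 𝟘 one
  series-isCommutativeRing = record
    { isRing = record
      { +-isAbelianGroup = record
        { isGroup = record
          { isMonoid = record
            { isSemigroup = record
              { isMagma = record
                { isEquivalence = record { refl = λ n → refl ; sym = λ e n → sym (e n) ; trans = λ e e′ n → trans (e n) (e′ n) }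
                ; ∙-cong = λ e e′ n → +-cong (e n) (e′ n) }
              ; assoc = λ f g h n → +-assoc _ _ _ }
            ; identity = (λ f n → +-identityˡ _) , (λ f n → +-identityʳ _) }
          ; inverse = (λ f n → -‿inverseˡ _) , (λ f n → -‿inverseʳ _)
          ; ⁻¹-cong = λ e n → -‿cong (e n) }
        ; comm = λ f g n → +-comm _ _ }
      ; *-cong = ⊗-cong
      ; *-assoc = ⊗-assoc
      ; *-identity = ⊗-identityˡ , (λ f n → trans (⊗-comm f one n) (⊗-identityˡ f n))
      ; distrib = ⊗-distribˡ , (λ h f g → ⊗-distribʳ f g h) }
    ; *-comm = ⊗-comm }

  SeriesRing : CommutativeRing c ℓ
  SeriesRing = record { isCommutativeRing = series-isCommutativeRing }

  conv≈⊗ : ∀ f g → conv f g ≋ f ⊗ g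
  conv≈⊗ f g zero    = +-identityˡ _
  conv≈⊗ f g (suc n) = trans (sum-peel (suc n) (λ i → f i * g (suc n N.∸ i))) (+-congˡ (conv≈⊗ (tail f) g n))

  z^_ : ℕ → Series
  z^ k = shift k one

  shift≈z^⊗ : ∀ k f → shift k f ≋ z^ k ⊗ f
  shift≈z^⊗ zero    f n       = sym (⊗-identityˡ f n)
  shift≈z^⊗ (suc k) f zero    = sym (zeroˡ _)
  shift≈z^⊗ (suc k) f (suc n) = trans (shift≈z^⊗ k f n) (sym (trans (+-congʳ (zeroˡ _)) (+-identityˡ _)))

  Deg≤ : ℕ → Series → Set ℓ
  Deg≤ d s = ∀ i → d < i → s i ≈ 0#

  Ord≥ : ℕ → Series → Set ℓ
  Ord≥ k s = ∀ i → i < k → s i ≈ 0#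

  Ord≥-cong : ∀ {k s t} → s ≋ t → Ord≥ k s → Ord≥ k t
  Ord≥-cong s≋t ord i i<k = trans (sym (s≋t i)) (ord i i<k)

  Deg≤-mono : ∀ {d d′ s} → d ≤ d′ → Deg≤ d s → Deg≤ d′ s
  Deg≤-mono d≤d′ deg i d′<i = deg i (NP.≤-<-trans d≤d′ d′<i)

  Ord≥-mono : ∀ {k k′ s} → k′ ≤ k → Ord≥ k s → Ord≥ k′ s
  Ord≥-mono k′≤k ord i i<k′ = ord i (NP.<-≤-trans i<k′ k′≤k)

  Deg≤-⊕ : ∀ {d s t} → Deg≤ d s → Deg≤ d t → Deg≤ d (s ⊕ t)
  Deg≤-⊕ deg-s deg-t i d<i = trans (+-cong (deg-s i d<i) (deg-t i d<i)) (+-identityˡ 0#)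

  Ord≥-⊕ : ∀ {k s t} → Ord≥ k s → Ord≥ k t → Ord≥ k (s ⊕ t)
  Ord≥-⊕ ord-s ord-t i i<k = trans (+-cong (ord-s i i<k) (ord-t i i<k)) (+-identityˡ 0#)

  Deg≤-⊝ : ∀ {d s} → Deg≤ d s → Deg≤ d (⊝ s)
  Deg≤-⊝ deg i d<i = trans (-‿cong (deg i d<i)) -0#≈0#

  Deg≤-const : ∀ x → Deg≤ 0 (const x)
  Deg≤-const x (suc i) _ = refl

  Deg≤-z^ : ∀ k → Deg≤ k (z^ k)
  Deg≤-z^ zero    (suc i) _         = refl
  Deg≤-z^ (suc k) (suc i) (s≤s k<i) = Deg≤-z^ k i k<i

  Ord≥-z^ : ∀ k → Ord≥ k (z^ k)
  Ord≥-z^ (suc k) zero    _         = refl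
  Ord≥-z^ (suc k) (suc i) (s≤s i<k) = Ord≥-z^ k i i<k

  Deg≤-⊗ : ∀ d e {f g} → Deg≤ d f → Deg≤ e g → Deg≤ (d N.+ e) (f ⊗ g)
  Deg≤-⊗ d       e {f} {g} deg-f deg-g zero    ()
  Deg≤-⊗ zero    e {f} {g} deg-f deg-g (suc n) e<n =
    trans (+-cong (trans (*-congˡ (deg-g (suc n) e<n)) (zeroʳ _)) (⊗-zeroˡ (tail f) g (λ k → deg-f (suc k) (s≤s z≤n)) n))
          (+-identityˡ 0#)
  Deg≤-⊗ (suc d) e {f} {g} deg-f deg-g (suc n) (s≤s d+e<n) =
    trans (+-cong (trans (*-congˡ (deg-g (suc n) (NP.≤-<-trans (NP.m≤n+m e d) (NP.m<n⇒m<1+n d+e<n)))) (zeroʳ _))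
                  (Deg≤-⊗ d e (λ k d<k → deg-f (suc k) (s≤s d<k)) deg-g n d+e<n))
          (+-identityˡ 0#)

  Ord≥-⊗ : ∀ k l {f g} → Ord≥ k f → Ord≥ l g → Ord≥ (k N.+ l) (f ⊗ g)
  Ord≥-⊗ zero    l {f} {g} ord-f ord-g zero    i<l = trans (*-congˡ (ord-g 0 i<l)) (zeroʳ _)
  Ord≥-⊗ zero    l {f} {g} ord-f ord-g (suc n) i<l =
    trans (+-cong (trans (*-congˡ (ord-g (suc n) i<l)) (zeroʳ _)) (Ord≥-⊗ zero l {tail f} (λ _ ()) ord-g n (NP.<-trans NP.≤-refl i<l)))
          (+-identityˡ 0#)
  Ord≥-⊗ (suc k) l {f} {g} ord-f ord-g zero    _ = trans (*-congʳ (ord-f 0 (s≤s z≤n))) (zeroˡ _)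
  Ord≥-⊗ (suc k) l {f} {g} ord-f ord-g (suc n) (s≤s i<k+l) =
    trans (+-cong (trans (*-congʳ (ord-f 0 (s≤s z≤n))) (zeroˡ _)) (Ord≥-⊗ k l (λ i i<k → ord-f (suc i) (s≤s i<k)) ord-g n i<k+l))
          (+-identityˡ 0#)

  leading-coefficient : ∀ k E u → Ord≥ k E → (E ⊗ u) k ≈ E k * u 0
  leading-coefficient zero    E u ord = refl
  leading-coefficient (suc k) E u ord =
    trans (+-cong (trans (*-congʳ (ord 0 (s≤s z≤n))) (zeroˡ _)) (leading-coefficient k (tail E) u (λ i i<k → ord (suc i) (s≤s i<k))))
          (+-identityˡ _)

  Ord≥-suc : ∀ k E → Ord≥ k E → E k ≈ 0# → Ord≥ (suc k) E
  Ord≥-suc k E ord Ek≈0 i (s≤s i≤k) with NP.m≤n⇒m<n∨m≡n i≤k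
  ... | inj₁ i<k    = ord i i<k
  ... | inj₂ P.refl = Ek≈0

  cancel-unit : ∀ K E u → u 0 ≈ 1# → Ord≥ K (E ⊗ u) → Ord≥ K E
  cancel-unit K E u u0≈1 ord = go K NP.≤-refl
    where
    go : ∀ k → k ≤ K → Ord≥ k E
    go zero    _   i ()
    go (suc k) k<K = Ord≥-suc k E (go k (NP.<⇒≤ k<K)) (begin
      E k                  ≈⟨ sym (*-identityʳ _) ⟩
      E k * 1#             ≈⟨ *-congˡ (sym u0≈1) ⟩
      E k * u 0            ≈⟨ sym (leading-coefficient k E u (go k (NP.<⇒≤ k<K))) ⟩
      (E ⊗ u) k            ≈⟨ ord k k<K ⟩
      0#                   ∎)

  cancel-unit-zero : ∀ E u → u 0 ≈ 1# → E ⊗ u ≋ 𝟘 → E ≋ 𝟘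
  cancel-unit-zero E u u0≈1 Eu≋0 n = cancel-unit (suc n) E u u0≈1 (λ i _ → Eu≋0 i) n NP.≤-refl

  cancel-two-zero : (∀ x → x + x ≈ 0# → x ≈ 0#) → ∀ E u → u 0 ≈ 1# + 1# → E ⊗ u ≋ 𝟘 → E ≋ 𝟘
  cancel-two-zero no-2-torsion E u u0≈2 Eu≋0 n = go (suc n) n NP.≤-refl
    where
    go : ∀ k → Ord≥ k E
    go zero    i ()
    go (suc k) = Ord≥-suc k E (go k) (no-2-torsion (E k) (begin
      E k + E k            ≈⟨ sym (+-cong (*-identityʳ _) (*-identityʳ _)) ⟩
      E k * 1# + E k * 1#  ≈⟨ sym (distribˡ _ _ _) ⟩
      E k * (1# + 1#)      ≈⟨ *-congˡ (sym u0≈2) ⟩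
      E k * u 0            ≈⟨ sym (leading-coefficient k E u (go k)) ⟩
      (E ⊗ u) k            ≈⟨ Eu≋0 k ⟩
      0#                   ∎))

  ⊗-cancel-unit : ∀ u X Y → u 0 ≈ 1# → u ⊗ X ≋ u ⊗ Y → X ≋ Y
  ⊗-cancel-unit u X Y u0≈1 uX≋uY = x∙y⁻¹≈ε⇒x≈y X Y
    (cancel-unit-zero (X ⊕ ⊝ Y) u u0≈1 (λ n → begin
      ((X ⊕ ⊝ Y) ⊗ u) n          ≈⟨ ⊗-comm _ u n ⟩
      (u ⊗ (X ⊕ ⊝ Y)) n          ≈⟨ ⊗-distribˡ u X (⊝ Y) n ⟩
      (u ⊗ X) n + (u ⊗ ⊝ Y) n    ≈⟨ +-congˡ (sym (-‿distribʳ-* u Y n)) ⟩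
      (u ⊗ X) n + - (u ⊗ Y) n    ≈⟨ x≈y⇒x∙y⁻¹≈ε uX≋uY n ⟩
      0#                         ∎))
    where
    open import Algebra.Properties.Group (CommutativeRing.+-group SeriesRing) using (x∙y⁻¹≈ε⇒x≈y; x≈y⇒x∙y⁻¹≈ε)
    open import Algebra.Properties.Ring (CommutativeRing.ring SeriesRing) using (-‿distribʳ-*)

  coefficient-gap : ∀ h Q P E d K → h ⊗ Q ≋ P ⊕ E → Deg≤ d P → Ord≥ K E →
    ∀ t → suc d ≤ t → t < K → conv h Q t ≈ 0#
  coefficient-gap h Q P E d K hQ≋P+E deg-P ord-E t d<t t<K = begin
    conv h Q t      ≈⟨ conv≈⊗ h Q t ⟩
    (h ⊗ Q) t       ≈⟨ hQ≋P+E t ⟩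
    P t + E t       ≈⟨ +-cong (deg-P t d<t) (ord-E t t<K) ⟩
    0# + 0#         ≈⟨ +-identityˡ 0# ⟩
    0#              ∎

module Determinants {c ℓ : Level} (R : CommutativeRing c ℓ) where
  open CommutativeRing R
  open PS R using (sumℕ; alt; sumFin; det)
  open FiniteSums R
  open IntegerSolver R using (solve; _:=_; _:+_; _:*_; :-_)
  open import Algebra.Properties.Ring ring using (-0#≈0#; -‿involutive; +-inverseʳ-unique)
  open import Relation.Binary.Reasoning.Setoid setoid

  Matrix : Set c
  Matrix = ℕ → ℕ → Carrier

  Column : Set c
  Column = ℕ → Carrier

  minor : Matrix → ℕ → Matrix
  minor A j i k = A (suc i) (punchIn′ j k)

  detℕ : ℕ → Matrix → Carrier
  detℕ zero    A = 1#
  detℕ (suc n) A = sumℕ (suc n) (λ j → alt j (A 0 j * detℕ n (minor A j)))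

  alt-cong : ∀ k {x y} → x ≈ y → alt k x ≈ alt k y
  alt-cong zero    x≈y = x≈y
  alt-cong (suc k) x≈y = -‿cong (alt-cong k x≈y)

  alt-zero : ∀ k {x} → x ≈ 0# → alt k x ≈ 0#
  alt-zero zero    x≈0 = x≈0
  alt-zero (suc k) x≈0 = trans (-‿cong (alt-zero k x≈0)) -0#≈0#

  alt-linear : ∀ k s t x y → alt k (s * x + t * y) ≈ s * alt k x + t * alt k y
  alt-linear zero    s t x y = refl
  alt-linear (suc k) s t x y = trans (-‿cong (alt-linear k s t x y))
    (solve 4 (λ s t x y → :- (s :* x :+ t :* y) := s :* (:- x) :+ t :* (:- y)) refl s t (alt k x) (alt k y))

  detℕ-cong-on : ∀ n {A B : Matrix} → (∀ i j → i < n → j < n → A i j ≈ B i j) → detℕ n A ≈ detℕ n B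
  detℕ-cong-on zero    A≈B = refl
  detℕ-cong-on (suc n) A≈B = sum-cong (suc n) (λ j j< → alt-cong j (*-cong (A≈B 0 j (s≤s z≤n) j<)
    (detℕ-cong-on n (λ i k i< k< → A≈B (suc i) (punchIn′ j k) (s≤s i<) (NP.≤-trans (s≤s (punchIn′-≤ j k)) (s≤s k<))))))

  detℕ-cong : ∀ n {A B : Matrix} → (∀ i j → A i j ≈ B i j) → detℕ n A ≈ detℕ n B
  detℕ-cong n A≈B = detℕ-cong-on n (λ i j _ _ → A≈B i j)

  sumFin-cong : ∀ {n} {f g : Fin n → Carrier} → (∀ j → f j ≈ g j) → sumFin f ≈ sumFin g
  sumFin-cong {zero}  f≈g = refl
  sumFin-cong {suc n} f≈g = +-cong (f≈g fz) (sumFin-cong (λ j → f≈g (fs j)))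

  sumFin≈sumℕ : ∀ n (f : ℕ → Carrier) → sumFin {n} (λ j → f (toℕ j)) ≈ sumℕ n f
  sumFin≈sumℕ zero    f = refl
  sumFin≈sumℕ (suc n) f = trans (+-congˡ (sumFin≈sumℕ n (λ j → f (suc j)))) (sym (sum-peel n f))

  det-cong : ∀ {n} {M M′ : Fin n → Fin n → Carrier} → (∀ i j → M i j ≈ M′ i j) → det M ≈ det M′
  det-cong {zero}  M≈M′ = refl
  det-cong {suc n} M≈M′ = sumFin-cong (λ j → alt-cong (toℕ j)
    (*-cong (M≈M′ fz j) (det-cong (λ i k → M≈M′ (fs i) (punchIn j k)))))

  det≈detℕ : ∀ n (A : Matrix) → det {n} (λ i j → A (toℕ i) (toℕ j)) ≈ detℕ n A
  det≈detℕ zero    A = refl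
  det≈detℕ (suc n) A = trans (sumFin-cong {suc n} expand) (sumFin≈sumℕ (suc n) (λ j → alt j (A 0 j * detℕ n (minor A j))))
    where
    expand : ∀ (j : Fin (suc n)) → alt (toℕ j) (A 0 (toℕ j) * det (λ i k → A (suc (toℕ i)) (toℕ (punchIn j k))))
                 ≈ alt (toℕ j) (A 0 (toℕ j) * detℕ n (minor A (toℕ j)))
    expand j = alt-cong (toℕ j) (*-congˡ (trans
      (det-cong {n} (λ i k → reflexive (P.cong (A (suc (toℕ i))) (toℕ-punchIn j k))))
      (det≈detℕ n (minor A (toℕ j)))))

  detℕ-linear : ∀ n c → c < n → (A B C : Matrix) (s t : Carrier) →
    (∀ i j → j ≢ c → A i j ≈ B i j) → (∀ i j → j ≢ c → A i j ≈ C i j) →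
    (∀ i → A i c ≈ s * B i c + t * C i c) → detℕ n A ≈ s * detℕ n B + t * detℕ n C
  detℕ-linear (suc n) c c< A B C s t A≈B A≈C col-c =
    trans (sum-cong (suc n) term) (sum-linear (suc n) s t _ _)
    where
    term : ∀ j → j < suc n → alt j (A 0 j * detℕ n (minor A j)) ≈
             s * alt j (B 0 j * detℕ n (minor B j)) + t * alt j (C 0 j * detℕ n (minor C j))
    term j j< with j N.≟ c
    ... | yes P.refl = trans (alt-cong j expanded) (alt-linear j s t _ _)
      where
      -- column c is deleted, so the three minors agree
      minors : detℕ n (minor A j) ≈ detℕ n (minor B j) × detℕ n (minor A j) ≈ detℕ n (minor C j)
      minors = detℕ-cong n (λ i k → A≈B (suc i) (punchIn′ j k) (punchIn′ᵢ≢i j k))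
             , detℕ-cong n (λ i k → A≈C (suc i) (punchIn′ j k) (punchIn′ᵢ≢i j k))
      expanded : A 0 j * detℕ n (minor A j) ≈ s * (B 0 j * detℕ n (minor B j)) + t * (C 0 j * detℕ n (minor C j))
      expanded = begin
        A 0 j * detℕ n (minor A j)                                       ≈⟨ *-congʳ (col-c 0) ⟩
        (s * B 0 j + t * C 0 j) * detℕ n (minor A j)
          ≈⟨ solve 5 (λ s t b c d → (s :* b :+ t :* c) :* d := s :* (b :* d) :+ t :* (c :* d)) refl s t (B 0 j) (C 0 j) _ ⟩
        s * (B 0 j * detℕ n (minor A j)) + t * (C 0 j * detℕ n (minor A j))
          ≈⟨ +-cong (*-congˡ (*-congˡ (proj₁ minors))) (*-congˡ (*-congˡ (proj₂ minors))) ⟩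
        s * (B 0 j * detℕ n (minor B j)) + t * (C 0 j * detℕ n (minor C j)) ∎
    ... | no j≢c = trans (alt-cong j expanded) (alt-linear j s t _ _)
      where
      -- column c survives in the minor, at position punchOut′ j c
      linear-minor : detℕ n (minor A j) ≈ s * detℕ n (minor B j) + t * detℕ n (minor C j)
      linear-minor = detℕ-linear n (punchOut′ j c) (punchOut′-< n j c j< c< j≢c) (minor A j) (minor B j) (minor C j) s t
        (λ i k k≢ → A≈B (suc i) (punchIn′ j k) (λ e → k≢ (hit e)))
        (λ i k k≢ → A≈C (suc i) (punchIn′ j k) (λ e → k≢ (hit e)))
        (λ i → P.subst (λ x → A (suc i) x ≈ s * B (suc i) x + t * C (suc i) x)
                       (P.sym (punchIn′-punchOut′ j c j≢c)) (col-c (suc i)))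
        where
        hit : ∀ {k} → punchIn′ j k ≡ c → k ≡ punchOut′ j c
        hit P.refl = P.sym (punchOut′-punchIn′ j _)
      expanded : A 0 j * detℕ n (minor A j) ≈ s * (B 0 j * detℕ n (minor B j)) + t * (C 0 j * detℕ n (minor C j))
      expanded = begin
        A 0 j * detℕ n (minor A j)                                       ≈⟨ *-congˡ linear-minor ⟩
        A 0 j * (s * detℕ n (minor B j) + t * detℕ n (minor C j))
          ≈⟨ solve 5 (λ a s t x y → a :* (s :* x :+ t :* y) := s :* (a :* x) :+ t :* (a :* y)) refl (A 0 j) s t _ _ ⟩
        s * (A 0 j * detℕ n (minor B j)) + t * (A 0 j * detℕ n (minor C j))
          ≈⟨ +-cong (*-congˡ (*-congʳ (A≈B 0 j j≢c))) (*-congˡ (*-congʳ (A≈C 0 j j≢c))) ⟩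
        s * (B 0 j * detℕ n (minor B j)) + t * (C 0 j * detℕ n (minor C j)) ∎

  detℕ-additive : ∀ n c → c < n → (A B C : Matrix) →
    (∀ i j → j ≢ c → A i j ≈ B i j) → (∀ i j → j ≢ c → A i j ≈ C i j) →
    (∀ i → A i c ≈ B i c + C i c) → detℕ n A ≈ detℕ n B + detℕ n C
  detℕ-additive n c c< A B C A≈B A≈C col-c =
    trans (detℕ-linear n c c< A B C 1# 1# A≈B A≈C (λ i → trans (col-c i) (sym one-times)))
          one-times
    where
    one-times : ∀ {x y} → 1# * x + 1# * y ≈ x + y
    one-times = +-cong (*-identityˡ _) (*-identityˡ _)

  detℕ-zero-column : ∀ n c → c < n → (A : Matrix) → (∀ i → A i c ≈ 0#) → detℕ n A ≈ 0#
  detℕ-zero-column n c c< A col-c =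
    trans (detℕ-linear n c c< A A A 0# 0# (λ _ _ _ → refl) (λ _ _ _ → refl) (λ i → trans (col-c i) (sym zero-times)))
          zero-times
    where
    zero-times : ∀ {x y} → 0# * x + 0# * y ≈ 0#
    zero-times = trans (+-cong (zeroˡ _) (zeroˡ _)) (+-identityˡ 0#)

  -- two equal adjacent columns: the terms of the expansion cancel in pairs
  detℕ-adjacent : ∀ n p → suc p < n → (A : Matrix) → (∀ i → A i p ≈ A i (suc p)) → detℕ n A ≈ 0#
  detℕ-adjacent (suc n) p sp< A col-p = trans (sum-pair (suc n) _ p (suc p) NP.≤-refl sp< others) cancel
    where
    same-minor : ∀ i k → minor A p i k ≈ minor A (suc p) i k
    same-minor i k with punchIn′-adjacent p k
    ... | inj₁ e      = reflexive (P.cong (A (suc i)) e)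
    ... | inj₂ P.refl = begin
      A (suc i) (punchIn′ p p)         ≡⟨ P.cong (A (suc i)) (punchIn′-self p) ⟩
      A (suc i) (suc p)                ≈⟨ sym (col-p (suc i)) ⟩
      A (suc i) p                      ≡⟨ P.cong (A (suc i)) (P.sym (punchIn′-suc-self p)) ⟩
      A (suc i) (punchIn′ (suc p) p)   ∎
    cancel : alt p (A 0 p * detℕ n (minor A p)) + alt (suc p) (A 0 (suc p) * detℕ n (minor A (suc p))) ≈ 0#
    cancel = trans (+-congˡ (-‿cong (alt-cong p (*-cong (sym (col-p 0)) (sym (detℕ-cong n same-minor))))))
                   (-‿inverseʳ _)
    -- every other minor still contains the two equal adjacent columns
    others : ∀ j → j < suc n → j ≢ p → j ≢ suc p → alt j (A 0 j * detℕ n (minor A j)) ≈ 0#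
    others j j< j≢p j≢sp = alt-zero j (trans (*-congˡ minor≈0) (zeroʳ _))
      where
      shifted : suc (punchOut′ j p) ≡ punchOut′ j (suc p)
      shifted = P.sym (punchOut′-suc j p j≢p j≢sp)
      minor≈0 : detℕ n (minor A j) ≈ 0#
      minor≈0 = detℕ-adjacent n (punchOut′ j p)
        (P.subst (_< n) (P.sym shifted) (punchOut′-< n j (suc p) j< sp< j≢sp)) (minor A j)
        (λ i → begin
          A (suc i) (punchIn′ j (punchOut′ j p))         ≡⟨ P.cong (A (suc i)) (punchIn′-punchOut′ j p j≢p) ⟩
          A (suc i) p                                    ≈⟨ col-p (suc i) ⟩
          A (suc i) (suc p)                              ≡⟨ P.cong (A (suc i)) (P.sym (punchIn′-punchOut′ j (suc p) j≢sp)) ⟩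
          A (suc i) (punchIn′ j (punchOut′ j (suc p)))   ≡⟨ P.cong (λ x → A (suc i) (punchIn′ j x)) (P.sym shifted) ⟩
          A (suc i) (punchIn′ j (suc (punchOut′ j p)))   ∎)

  replaceCol : Matrix → ℕ → Column → Matrix
  replaceCol A c u i j with j N.≟ c
  ... | yes _ = u i
  ... | no _  = A i j

  replaceCol-hit : ∀ A c u i → replaceCol A c u i c ≡ u i
  replaceCol-hit A c u i with c N.≟ c
  ... | yes _  = P.refl
  ... | no c≢c = ⊥-elim (c≢c P.refl)

  replaceCol-miss : ∀ A c u i j → j ≢ c → replaceCol A c u i j ≡ A i j
  replaceCol-miss A c u i j j≢c with j N.≟ c
  ... | yes j≡c = ⊥-elim (j≢c j≡c)
  ... | no _    = P.refl

  setPair : Matrix → ℕ → Column → Column → Matrix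
  setPair A p x y = replaceCol (replaceCol A p x) (suc p) y

  setPair-fst : ∀ A p x y i → setPair A p x y i p ≡ x i
  setPair-fst A p x y i = P.trans (replaceCol-miss _ (suc p) y i p (λ e → NP.1+n≢n (P.sym e))) (replaceCol-hit A p x i)

  setPair-snd : ∀ A p x y i → setPair A p x y i (suc p) ≡ y i
  setPair-snd A p x y i = replaceCol-hit _ (suc p) y i

  setPair-other : ∀ A p x y i j → j ≢ p → j ≢ suc p → setPair A p x y i j ≡ A i j
  setPair-other A p x y i j j≢p j≢sp = P.trans (replaceCol-miss _ (suc p) y i j j≢sp) (replaceCol-miss A p x i j j≢p)

  setPair-self : ∀ A p i j → setPair A p (λ i → A i p) (λ i → A i (suc p)) i j ≡ A i j
  setPair-self A p i j = by-cases (j N.≟ suc p) (j N.≟ p)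
    where
    by-cases : Dec (j ≡ suc p) → Dec (j ≡ p) → setPair A p (λ i → A i p) (λ i → A i (suc p)) i j ≡ A i j
    by-cases (yes P.refl) _            = setPair-snd A p _ _ i
    by-cases (no _)       (yes P.refl) = setPair-fst A p _ _ i
    by-cases (no j≢sp)    (no j≢p)     = setPair-other A p _ _ i j j≢p j≢sp

  setPair-off-fst : ∀ A p x x′ y i j → j ≢ p → setPair A p x y i j ≡ setPair A p x′ y i j
  setPair-off-fst A p x x′ y i j j≢p = by-cases (j N.≟ suc p)
    where
    by-cases : Dec (j ≡ suc p) → setPair A p x y i j ≡ setPair A p x′ y i j
    by-cases (yes P.refl) = P.trans (setPair-snd A p x y i) (P.sym (setPair-snd A p x′ y i))
    by-cases (no j≢sp)    = P.trans (setPair-other A p x y i j j≢p j≢sp) (P.sym (setPair-other A p x′ y i j j≢p j≢sp))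

  _⊕ᶜ_ : Column → Column → Column
  (x ⊕ᶜ y) i = x i + y i

  detℕ-setPair-additiveˡ : ∀ n p → suc p < n → ∀ A x x′ y →
    detℕ n (setPair A p (x ⊕ᶜ x′) y) ≈ detℕ n (setPair A p x y) + detℕ n (setPair A p x′ y)
  detℕ-setPair-additiveˡ n p sp< A x x′ y = detℕ-additive n p (NP.<-trans NP.≤-refl sp<) _ _ _
    (λ i j j≢p → reflexive (setPair-off-fst A p _ x y i j j≢p))
    (λ i j j≢p → reflexive (setPair-off-fst A p _ x′ y i j j≢p))
    (λ i → reflexive (P.trans (setPair-fst A p _ y i) (P.sym (P.cong₂ _+_ (setPair-fst A p x y i) (setPair-fst A p x′ y i)))))

  detℕ-setPair-additiveʳ : ∀ n p → suc p < n → ∀ A x y y′ →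
    detℕ n (setPair A p x (y ⊕ᶜ y′)) ≈ detℕ n (setPair A p x y) + detℕ n (setPair A p x y′)
  detℕ-setPair-additiveʳ n p sp< A x y y′ = detℕ-additive n (suc p) sp< _ _ _ off off
    (λ i → reflexive (P.trans (setPair-snd A p x _ i) (P.sym (P.cong₂ _+_ (setPair-snd A p x y i) (setPair-snd A p x y′ i)))))
    where
    off : ∀ {w w′} i j → j ≢ suc p → setPair A p x w i j ≈ setPair A p x w′ i j
    off i j j≢sp = reflexive (P.trans (replaceCol-miss _ _ _ i j j≢sp) (P.sym (replaceCol-miss _ _ _ i j j≢sp)))

  detℕ-setPair-diagonal : ∀ n p → suc p < n → ∀ A x → detℕ n (setPair A p x x) ≈ 0#
  detℕ-setPair-diagonal n p sp< A x =
    detℕ-adjacent n p sp< _ (λ i → reflexive (P.trans (setPair-fst A p x x i) (P.sym (setPair-snd A p x x i))))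

  swapCols : Matrix → ℕ → Matrix
  swapCols A p = setPair A p (λ i → A i (suc p)) (λ i → A i p)

  -- interchanging two adjacent columns negates the determinant: expand
  -- D(u+v, u+v) = 0 by additivity, where D x y is the determinant with columns
  -- p, p+1 replaced by x, y and u, v are the original columns
  detℕ-swap : ∀ n p → suc p < n → (A : Matrix) → detℕ n (swapCols A p) ≈ - detℕ n A
  detℕ-swap n p sp< A = +-inverseʳ-unique (detℕ n A) (detℕ n (swapCols A p)) (begin
    detℕ n A + D v u                        ≈⟨ sym (+-cong (trans (trans (+-congʳ (diagonal u)) (+-identityˡ _)) unchanged)
                                                           (trans (+-congˡ (diagonal v)) (+-identityʳ _))) ⟩
    (D u u + D u v) + (D v u + D v v)       ≈⟨ sym (+-cong (detℕ-setPair-additiveʳ n p sp< A u u v)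
                                                           (detℕ-setPair-additiveʳ n p sp< A v u v)) ⟩
    D u (u ⊕ᶜ v) + D v (u ⊕ᶜ v)             ≈⟨ sym (detℕ-setPair-additiveˡ n p sp< A u v (u ⊕ᶜ v)) ⟩
    D (u ⊕ᶜ v) (u ⊕ᶜ v)                     ≈⟨ diagonal (u ⊕ᶜ v) ⟩
    0#                                      ∎)
    where
    D : Column → Column → Carrier
    D x y = detℕ n (setPair A p x y)
    u v : Column
    u i = A i p
    v i = A i (suc p)
    diagonal : ∀ x → D x x ≈ 0#
    diagonal = detℕ-setPair-diagonal n p sp< A
    unchanged : D u v ≈ detℕ n A
    unchanged = detℕ-cong n (λ i j → reflexive (setPair-self A p i j))

  -- two equal columns c < c′: move column c′ next to column c by adjacent swaps
  detℕ-equal-columns : ∀ n c c′ → c < c′ → c′ < n → (A : Matrix) → (∀ i → A i c ≈ A i c′) → detℕ n A ≈ 0#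
  detℕ-equal-columns n c (suc q) c<sq sq< A cols with c N.≟ q
  ... | yes P.refl = detℕ-adjacent n c sq< A cols
  ... | no c≢q     = begin
    detℕ n A                           ≈⟨ sym (-‿involutive _) ⟩
    - (- detℕ n A)                     ≈⟨ -‿cong (sym (detℕ-swap n q sq< A)) ⟩
    - detℕ n (swapCols A q)            ≈⟨ -‿cong swapped≈0 ⟩
    - 0#                               ≈⟨ -0#≈0# ⟩
    0#                                 ∎
    where
    c<q : c < q
    c<q = NP.≤∧≢⇒< (NP.≤-pred c<sq) c≢q
    swapped≈0 : detℕ n (swapCols A q) ≈ 0#
    swapped≈0 = detℕ-equal-columns n c q c<q (NP.<-trans NP.≤-refl sq<) (swapCols A q) (λ i → begin
      swapCols A q i c    ≡⟨ setPair-other A q _ _ i c c≢q (λ e → NP.<-irrefl e (NP.<-trans c<q NP.≤-refl)) ⟩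
      A i c               ≈⟨ cols i ⟩
      A i (suc q)         ≡⟨ P.sym (setPair-fst A q _ _ i) ⟩
      swapCols A q i q    ∎)

  detℕ-repeated-column : ∀ n c c′ → c ≢ c′ → c < n → c′ < n → (A : Matrix) → (∀ i → A i c ≈ A i c′) → detℕ n A ≈ 0#
  detℕ-repeated-column n c c′ c≢c′ c< c′< A cols with NP.<-cmp c c′
  ... | tri< c<c′ _ _ = detℕ-equal-columns n c c′ c<c′ c′< A cols
  ... | tri≈ _ c≡c′ _ = ⊥-elim (c≢c′ c≡c′)
  ... | tri> _ _ c′<c = detℕ-equal-columns n c′ c c′<c c< A (λ i → sym (cols i))

  detℕ-kernel : ∀ n (A : Matrix) (v : Column) D → D < n → v D ≈ 1# →
    (∀ i → i < n → sumℕ n (λ j → v j * A i j) ≈ 0#) → detℕ n A ≈ 0#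
  detℕ-kernel n A v D D< vD≈1 Av≈0 = begin
    detℕ n A                                                    ≈⟨ sym (*-identityˡ _) ⟩
    1# * detℕ n A                                               ≈⟨ *-cong (sym vD≈1) (sym (detℕ-cong n restore)) ⟩
    v D * detℕ n (with-col D)                                   ≈⟨ sym (sum-single n _ D D< repeated) ⟩
    sumℕ n (λ j → v j * detℕ n (with-col j))                    ≈⟨ sym (expand n) ⟩
    detℕ n (replaceCol A D (λ i → sumℕ n (λ j → v j * A i j))) ≈⟨ detℕ-cong-on n (λ i j i< _ → zero-inside i j i<) ⟩
    detℕ n (replaceCol A D (λ _ → 0#))                          ≈⟨ detℕ-zero-column n D D< _ (λ i → reflexive (replaceCol-hit A D _ i)) ⟩
    0#                                                          ∎
    where
    with-col : ℕ → Matrix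
    with-col j = replaceCol A D (λ i → A i j)
    restore : ∀ i j → with-col D i j ≈ A i j
    restore i j with j N.≟ D
    ... | yes P.refl = refl
    ... | no _       = refl
    repeated : ∀ j → j < n → j ≢ D → v j * detℕ n (with-col j) ≈ 0#
    repeated j j< j≢D = trans (*-congˡ (detℕ-repeated-column n j D j≢D j< D< (with-col j) (λ i →
      reflexive (P.trans (replaceCol-miss A D _ i j j≢D) (P.sym (replaceCol-hit A D _ i)))))) (zeroʳ _)
    zero-inside : ∀ i j → i < n → replaceCol A D (λ i → sumℕ n (λ j → v j * A i j)) i j ≈ replaceCol A D (λ _ → 0#) i j
    zero-inside i j i< with j N.≟ D
    ... | yes _ = Av≈0 i i<
    ... | no _  = refl
    off : ∀ {u u′} i j → j ≢ D → replaceCol A D u i j ≈ replaceCol A D u′ i j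
    off i j j≢D = reflexive (P.trans (replaceCol-miss A D _ i j j≢D) (P.sym (replaceCol-miss A D _ i j j≢D)))
    expand : ∀ m → detℕ n (replaceCol A D (λ i → sumℕ m (λ j → v j * A i j))) ≈ sumℕ m (λ j → v j * detℕ n (with-col j))
    expand zero    = detℕ-zero-column n D D< _ (λ i → reflexive (replaceCol-hit A D _ i))
    expand (suc m) = trans
      (detℕ-linear n D D< _ _ (with-col m) 1# (v m) off off (λ i → begin
        replaceCol A D (λ i → sumℕ (suc m) (λ j → v j * A i j)) i D   ≡⟨ replaceCol-hit A D _ i ⟩
        sumℕ m (λ j → v j * A i j) + v m * A i m                     ≈⟨ +-congʳ (sym (*-identityˡ _)) ⟩
        1# * sumℕ m (λ j → v j * A i j) + v m * A i m                ≡⟨ P.sym (P.cong₂ (λ x y → 1# * x + v m * y)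
                                                                          (replaceCol-hit A D _ i) (replaceCol-hit A D _ i)) ⟩
        1# * replaceCol A D _ i D + v m * with-col m i D             ∎))
      (+-congʳ (trans (*-identityˡ _) (expand m)))

-- The arithmetic of the window: with x = mn, the rows of the Hankel matrix of
-- size x + k shifted by s reach index (x + k + s) + (x + 1) ≤ 2x + m.
rows-fit : ∀ m n k s → k N.+ suc s ≤ m → ((m N.* n N.+ k) N.+ s) N.+ suc (m N.* n) ≤ (m N.+ m) N.* n N.+ m
rows-fit m n k s k+s<m = begin
  ((x N.+ k) N.+ s) N.+ suc x   ≡⟨ rearrange x k s ⟩
  (x N.+ x) N.+ (k N.+ suc s)   ≤⟨ NP.+-monoʳ-≤ (x N.+ x) k+s<m ⟩
  (x N.+ x) N.+ m               ≡⟨ P.cong (N._+ m) (P.sym (NP.*-distribʳ-+ n m m)) ⟩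
  (m N.+ m) N.* n N.+ m         ∎
  where
  open NP.≤-Reasoning
  open import Data.Nat.Tactic.RingSolver using (solve-∀)
  x = m N.* n
  rearrange : ∀ x k s → ((x N.+ k) N.+ s) N.+ suc x ≡ (x N.+ x) N.+ (k N.+ suc s)
  rearrange = solve-∀

module HankelCriterion {c ℓ : Level} (R : CommutativeRing c ℓ) where
  open CommutativeRing R
  open PS R using (Series; sumℕ; conv; det; hankel)
  open FiniteSums R
  open PowerSeries R using (Deg≤)
  open Determinants R
  open import Relation.Binary.Reasoning.Setoid setoid
  open import Algebra.Properties.CommutativeSemigroup NP.+-commutativeSemigroup using (xy∙z≈xz∙y)

  conv-window : ∀ (h Q : Series) D a → Deg≤ D Q →
    conv h Q (a N.+ D) ≈ sumℕ (suc D) (λ j → h (a N.+ j) * Q (D N.∸ j))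
  conv-window h Q D a degQ = begin
    sumℕ (suc (a N.+ D)) g                      ≡⟨ P.cong (λ x → sumℕ x g) (P.sym (NP.+-suc a D)) ⟩
    sumℕ (a N.+ suc D) g                        ≈⟨ sum-split a (suc D) g ⟩
    sumℕ a g + sumℕ (suc D) (λ j → g (a N.+ j)) ≈⟨ +-congʳ (sum-zero a g early) ⟩
    0# + sumℕ (suc D) (λ j → g (a N.+ j))       ≈⟨ +-identityˡ _ ⟩
    sumℕ (suc D) (λ j → g (a N.+ j))            ≈⟨ sum-cong (suc D) (λ j _ → reflexive
                                                     (P.cong (λ x → h (a N.+ j) * Q x) (NP.[m+n]∸[m+o]≡n∸o a D j))) ⟩
    sumℕ (suc D) (λ j → h (a N.+ j) * Q (D N.∸ j)) ∎
    where
    g : ℕ → Carrier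
    g l = h l * Q ((a N.+ D) N.∸ l)
    early : ∀ l → l < a → g l ≈ 0#
    early l l<a = trans (*-congˡ (degQ _ D<)) (zeroʳ _)
      where
      D< : D < (a N.+ D) N.∸ l
      D< = P.subst (D <_) (P.sym (NP.+-∸-comm D (NP.<⇒≤ l<a))) (NP.m<n+m D (NP.m<n⇒0<n∸m l<a))

  reversal : ℕ → Series → Column
  reversal D Q j with j N.≤? D
  ... | yes _ = Q (D N.∸ j)
  ... | no _  = 0#

  reversal-≤ : ∀ D Q j → j ≤ D → reversal D Q j ≈ Q (D N.∸ j)
  reversal-≤ D Q j j≤D with j N.≤? D
  ... | yes _   = refl
  ... | no j≰D  = ⊥-elim (j≰D j≤D)

  reversal-> : ∀ D Q j → D < j → reversal D Q j ≈ 0#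
  reversal-> D Q j D<j with j N.≤? D
  ... | yes j≤D = ⊥-elim (NP.<-irrefl P.refl (NP.<-≤-trans D<j j≤D))
  ... | no _    = refl

  hankel-vanishes : ∀ (h Q : Series) (D K n s : ℕ) → Q 0 ≈ 1# → Deg≤ D Q →
    (∀ t → D ≤ t → t < K → conv h Q t ≈ 0#) → D < n → (n N.+ s) N.+ D ≤ K → det (hankel h s n) ≈ 0#
  hankel-vanishes h Q D K n s Q0≈1 degQ annihilated D<n fits =
    trans (det≈detℕ n A) (detℕ-kernel n A v D D<n vD≈1 row)
    where
    A : Matrix
    A i j = h ((i N.+ j) N.+ s)
    v : Column
    v = reversal D Q
    vD≈1 : v D ≈ 1#
    vD≈1 = trans (reversal-≤ D Q D NP.≤-refl) (trans (reflexive (P.cong Q (NP.n∸n≡0 D))) Q0≈1)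
    row : ∀ i → i < n → sumℕ n (λ j → v j * A i j) ≈ 0#
    row i i<n = begin
      sumℕ n f                                             ≡⟨ P.cong (λ x → sumℕ x f) (P.sym (NP.m+[n∸m]≡n D<n)) ⟩
      sumℕ (suc D N.+ e) f                                 ≈⟨ sum-split (suc D) e f ⟩
      sumℕ (suc D) f + sumℕ e (λ j → f (suc D N.+ j))      ≈⟨ +-congˡ (sum-zero e _ (λ j _ → beyond (suc D N.+ j) (s≤s (NP.m≤m+n D j)))) ⟩
      sumℕ (suc D) f + 0#                                  ≈⟨ +-identityʳ _ ⟩
      sumℕ (suc D) f                                       ≈⟨ sum-cong (suc D) (λ j j≤D → within j (NP.≤-pred j≤D)) ⟩
      sumℕ (suc D) (λ j → h (a N.+ j) * Q (D N.∸ j))       ≈⟨ sym (conv-window h Q D a degQ) ⟩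
      conv h Q (a N.+ D)                                   ≈⟨ annihilated (a N.+ D) (NP.m≤n+m D a) below ⟩
      0#                                                   ∎
      where
      a = i N.+ s
      e = n N.∸ suc D
      f : ℕ → Carrier
      f j = v j * A i j
      beyond : ∀ j → D < j → f j ≈ 0#
      beyond j D<j = trans (*-congʳ (reversal-> D Q j D<j)) (zeroˡ _)
      within : ∀ j → j ≤ D → f j ≈ h (a N.+ j) * Q (D N.∸ j)
      within j j≤D = trans (*-comm _ _) (*-cong (reflexive (P.cong h (xy∙z≈xz∙y i j s))) (reversal-≤ D Q j j≤D))
      below : a N.+ D < K
      below = NP.<-≤-trans (NP.+-monoˡ-< D (NP.+-monoˡ-< s i<n)) fits

  hankel-family : ∀ (h Q : Series) m n → Q 0 ≈ 1# → Deg≤ (suc (m N.* n)) Q →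
    (∀ t → suc (m N.* n) ≤ t → t < (m N.+ m) N.* n N.+ m → conv h Q t ≈ 0#) →
    ∀ s k → 2 ≤ k → k N.+ suc s ≤ m → det (hankel h s (m N.* n N.+ k)) ≈ 0#
  hankel-family h Q m n Q0≈1 deg-Q gap s k 2≤k k+s<m =
    hankel-vanishes h Q (suc (m N.* n)) _ (m N.* n N.+ k) s Q0≈1 deg-Q gap
      (P.subst (_≤ m N.* n N.+ k) (NP.+-comm (m N.* n) 2) (NP.+-monoʳ-≤ (m N.* n) 2≤k))
      (rows-fit m n k s k+s<m)

module Approximants {c ℓ : Level} (R : CommutativeRing c ℓ) (m : ℕ) (2≤m : 2 ≤ m)
    (a b : CommutativeRing.Carrier R) (f : PS.Series R) (isF : PS.IsF R m a b f) where
  open CommutativeRing R hiding (zero)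
  open PS R using (Series; one; conv; shift; oneMinusAz)
  open PowerSeries R
  module S = CommutativeRing SeriesRing
  open IntegerSolver SeriesRing using (solve; _:=_; _:+_; _:-_; _:*_; con; Polynomial)
  open import Algebra.Properties.Ring ring using (-0#≈0#)
  open import Algebra.Properties.Group S.+-group using (x≈y⇒x∙y⁻¹≈ε)
  open import Relation.Binary.Reasoning.Setoid S.setoid

  I : ∀ {k} → Polynomial k
  I = con (+ 1)

  0<m : 0 < m
  0<m = NP.<-≤-trans (s≤s z≤n) 2≤m

  W β Y τ : Series
  W = oneMinusAz a
  β = const b ⊗ z^ m
  Y = W ⊗ f ⊕ ⊝ one
  τ = W ⊗ W ⊕ ⊝ (β ⊕ β)

  W-expansion : W ≋ one ⊕ ⊝ (const a ⊗ z^ 1)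
  W-expansion n = sym (trans (+-congˡ (-‿cong (⊗-constˡ a (z^ 1) n))) (coefficients n))
    where
    coefficients : ∀ n → one n + - (a * (z^ 1) n) ≈ W n
    coefficients zero          = trans (+-congˡ (trans (-‿cong (zeroʳ a)) -0#≈0#)) (+-identityʳ _)
    coefficients (suc zero)    = trans (+-congˡ (-‿cong (*-identityʳ a))) (+-identityˡ _)
    coefficients (suc (suc n)) = trans (+-congˡ (trans (-‿cong (zeroʳ a)) -0#≈0#)) (+-identityʳ _)

  f-equation : f ≋ (one ⊕ const a ⊗ (z^ 1 ⊗ f)) ⊕ β ⊗ (f ⊗ f)
  f-equation n = trans (isF n) (+-cong (+-congˡ a-term) b-term)
    where
    a-term : a * shift 1 f n ≈ (const a ⊗ (z^ 1 ⊗ f)) n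
    a-term = trans (*-congˡ (shift≈z^⊗ 1 f n)) (sym (⊗-constˡ a _ n))
    b-term : b * shift m (conv f f) n ≈ (β ⊗ (f ⊗ f)) n
    b-term = trans (*-congˡ (trans (shift≈z^⊗ m (conv f f) n) (⊗-cong (λ _ → refl) (conv≈⊗ f f) n)))
                   (trans (sym (⊗-constˡ b _ n)) (sym (⊗-assoc (const b) (z^ m) (f ⊗ f) n)))

  Wf≋1+Y : W ⊗ f ≋ one ⊕ Y
  Wf≋1+Y = solve 2 (λ w f → w :* f := I :+ (w :* f :- I)) S.refl W f

  Y≋βf² : Y ≋ β ⊗ (f ⊗ f)
  Y≋βf² = begin
    W ⊗ f ⊕ ⊝ one                                            ≈⟨ S.+-congʳ (S.*-congʳ W-expansion) ⟩
    (one ⊕ ⊝ (const a ⊗ z^ 1)) ⊗ f ⊕ ⊝ one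
      ≈⟨ solve 4 (λ f ka z β → (I :- ka :* z) :* f :- I := (f :- ((I :+ ka :* (z :* f)) :+ β :* (f :* f))) :+ β :* (f :* f))
               S.refl f (const a) (z^ 1) β ⟩
    (f ⊕ ⊝ ((one ⊕ const a ⊗ (z^ 1 ⊗ f)) ⊕ β ⊗ (f ⊗ f))) ⊕ β ⊗ (f ⊗ f) ≈⟨ S.+-congʳ (x≈y⇒x∙y⁻¹≈ε f-equation) ⟩
    𝟘 ⊕ β ⊗ (f ⊗ f)                                          ≈⟨ S.+-identityˡ _ ⟩
    β ⊗ (f ⊗ f)                                              ∎

  W²Y≋β[1+Y]² : (W ⊗ W) ⊗ Y ≋ β ⊗ ((one ⊕ Y) ⊗ (one ⊕ Y))
  W²Y≋β[1+Y]² = begin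
    (W ⊗ W) ⊗ Y                              ≈⟨ S.*-congˡ Y≋βf² ⟩
    (W ⊗ W) ⊗ (β ⊗ (f ⊗ f))                   ≈⟨ solve 3 (λ w f β → (w :* w) :* (β :* (f :* f)) := β :* ((w :* f) :* (w :* f))) S.refl W f β ⟩
    β ⊗ ((W ⊗ f) ⊗ (W ⊗ f))                   ≈⟨ S.*-congˡ (S.*-cong Wf≋1+Y Wf≋1+Y) ⟩
    β ⊗ ((one ⊕ Y) ⊗ (one ⊕ Y))               ∎

  quadratic : τ ⊗ Y ≋ β ⊗ (Y ⊗ Y) ⊕ β
  quadratic = begin
    τ ⊗ Y                                                   ≈⟨ solve 3 (λ w y β → (w :* w :- (β :+ β)) :* y := (w :* w) :* y :- (β :+ β) :* y) S.refl W Y β ⟩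
    (W ⊗ W) ⊗ Y ⊕ ⊝ ((β ⊕ β) ⊗ Y)                            ≈⟨ S.+-congʳ W²Y≋β[1+Y]² ⟩
    β ⊗ ((one ⊕ Y) ⊗ (one ⊕ Y)) ⊕ ⊝ ((β ⊕ β) ⊗ Y)            ≈⟨ solve 2 (λ y β → β :* ((I :+ y) :* (I :+ y)) :- (β :+ β) :* y := β :* (y :* y) :+ β) S.refl Y β ⟩
    β ⊗ (Y ⊗ Y) ⊕ β                                          ∎

  -- solutions of the three-term recurrence X (n+2) = τ X (n+1) - β² X n,
  -- the denominators and numerators of the continued fraction of Y
  recurrence : Series → Series → ℕ → Series
  recurrence x₀ x₁ zero          = x₀
  recurrence x₀ x₁ (suc zero)    = x₁
  recurrence x₀ x₁ (suc (suc n)) = τ ⊗ recurrence x₀ x₁ (suc n) ⊕ ⊝ ((β ⊗ β) ⊗ recurrence x₀ x₁ n)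

  A B : ℕ → Series
  A = recurrence one τ
  B = recurrence 𝟘 β

  μ : Series
  μ = β ⊗ Y

  μ^_ : ℕ → Series
  μ^ zero  = one
  μ^ suc n = μ ⊗ μ^ n

  E : ℕ → Series
  E n = μ^ n ⊗ Y

  approximation : ∀ n → A n ⊗ Y ≋ B n ⊕ E n
  approximation zero          = S.sym (S.+-identityˡ _)
  approximation (suc zero)    = begin
    τ ⊗ Y                      ≈⟨ quadratic ⟩
    β ⊗ (Y ⊗ Y) ⊕ β            ≈⟨ solve 2 (λ y β → β :* (y :* y) :+ β := β :+ ((β :* y) :* I) :* y) S.refl Y β ⟩
    β ⊕ (μ ⊗ one) ⊗ Y          ∎
  approximation (suc (suc n)) = begin
    (τ ⊗ A₁ ⊕ ⊝ ((β ⊗ β) ⊗ A₀)) ⊗ Y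
      ≈⟨ solve 5 (λ t a₁ a₀ y β → (t :* a₁ :- (β :* β) :* a₀) :* y := t :* (a₁ :* y) :- (β :* β) :* (a₀ :* y)) S.refl τ A₁ A₀ Y β ⟩
    τ ⊗ (A₁ ⊗ Y) ⊕ ⊝ ((β ⊗ β) ⊗ (A₀ ⊗ Y))
      ≈⟨ S.+-cong (S.*-congˡ (approximation (suc n))) (S.-‿cong (S.*-congˡ (approximation n))) ⟩
    τ ⊗ (B₁ ⊕ (μ ⊗ P₀) ⊗ Y) ⊕ ⊝ ((β ⊗ β) ⊗ (B₀ ⊕ P₀ ⊗ Y))
      ≈⟨ solve 6 (λ t b₁ b₀ p₀ y β →
            t :* (b₁ :+ ((β :* y) :* p₀) :* y) :- (β :* β) :* (b₀ :+ p₀ :* y) :=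
            (t :* b₁ :- (β :* β) :* b₀) :+ p₀ :* ((β :* y) :* (t :* y) :- (β :* β) :* y))
            S.refl τ B₁ B₀ P₀ Y β ⟩
    (τ ⊗ B₁ ⊕ ⊝ ((β ⊗ β) ⊗ B₀)) ⊕ P₀ ⊗ (μ ⊗ (τ ⊗ Y) ⊕ ⊝ ((β ⊗ β) ⊗ Y))
      ≈⟨ S.+-congˡ (S.*-congˡ (S.+-congʳ (S.*-congˡ quadratic))) ⟩
    (τ ⊗ B₁ ⊕ ⊝ ((β ⊗ β) ⊗ B₀)) ⊕ P₀ ⊗ (μ ⊗ (β ⊗ (Y ⊗ Y) ⊕ β) ⊕ ⊝ ((β ⊗ β) ⊗ Y))
      ≈⟨ S.+-congˡ (solve 3 (λ p₀ y β →
            p₀ :* ((β :* y) :* (β :* (y :* y) :+ β) :- (β :* β) :* y) := ((β :* y) :* ((β :* y) :* p₀)) :* y)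
            S.refl P₀ Y β) ⟩
    (τ ⊗ B₁ ⊕ ⊝ ((β ⊗ β) ⊗ B₀)) ⊕ (μ ⊗ (μ ⊗ P₀)) ⊗ Y       ∎
    where
    A₁ = A (suc n)
    A₀ = A n
    B₁ = B (suc n)
    B₀ = B n
    P₀ = μ^ n

  Deg≤-W : Deg≤ 1 W
  Deg≤-W (suc zero)    (s≤s ())
  Deg≤-W (suc (suc i)) _ = refl

  Deg≤-β : Deg≤ m β
  Deg≤-β = Deg≤-⊗ 0 m (Deg≤-const b) (Deg≤-z^ m)

  Deg≤-τ : Deg≤ m τ
  Deg≤-τ = Deg≤-⊕ (Deg≤-mono 2≤m (Deg≤-⊗ 1 1 Deg≤-W Deg≤-W)) (Deg≤-⊝ (Deg≤-⊕ Deg≤-β Deg≤-β))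

  Deg≤-recurrence : ∀ {x₀ x₁} → Deg≤ 0 x₀ → Deg≤ m x₁ → ∀ n → Deg≤ (m N.* n) (recurrence x₀ x₁ n)
  Deg≤-recurrence deg₀ deg₁ zero          = Deg≤-mono z≤n deg₀
  Deg≤-recurrence deg₀ deg₁ (suc zero)    = Deg≤-mono (NP.≤-reflexive (P.sym (NP.*-identityʳ m))) deg₁
  Deg≤-recurrence deg₀ deg₁ (suc (suc n)) = Deg≤-⊕
    (Deg≤-mono (NP.≤-reflexive (P.sym (NP.*-suc m (suc n))))
      (Deg≤-⊗ m _ Deg≤-τ (Deg≤-recurrence deg₀ deg₁ (suc n))))
    (Deg≤-⊝ (Deg≤-mono (NP.≤-reflexive two-steps)
      (Deg≤-⊗ (m N.+ m) _ (Deg≤-⊗ m m Deg≤-β Deg≤-β) (Deg≤-recurrence deg₀ deg₁ n))))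
    where
    two-steps : (m N.+ m) N.+ m N.* n ≡ m N.* suc (suc n)
    two-steps = P.trans (NP.+-assoc m m (m N.* n))
                (P.trans (P.cong (m N.+_) (P.sym (NP.*-suc m n))) (P.sym (NP.*-suc m (suc n))))

  Deg≤-A : ∀ n → Deg≤ (m N.* n) (A n)
  Deg≤-A = Deg≤-recurrence (λ { (suc i) _ → refl }) Deg≤-τ

  Deg≤-B : ∀ n → Deg≤ (m N.* n) (B n)
  Deg≤-B = Deg≤-recurrence (λ _ _ → refl) Deg≤-β

  β0≈0 : β 0 ≈ 0#
  β0≈0 = trans (*-congˡ (Ord≥-z^ m 0 0<m)) (zeroʳ b)

  τ0≈1 : τ 0 ≈ 1#
  τ0≈1 = trans (+-cong (*-identityˡ 1#) (trans (-‿cong (trans (+-cong β0≈0 β0≈0) (+-identityˡ 0#))) -0#≈0#))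
               (+-identityʳ 1#)

  recurrence-at-0 : ∀ {x₀ x₁ e} → x₀ 0 ≈ e → x₁ 0 ≈ e → ∀ n → recurrence x₀ x₁ n 0 ≈ e
  recurrence-at-0 x₀≈e x₁≈e zero          = x₀≈e
  recurrence-at-0 x₀≈e x₁≈e (suc zero)    = x₁≈e
  recurrence-at-0 x₀≈e x₁≈e (suc (suc n)) =
    trans (+-cong (trans (*-cong τ0≈1 (recurrence-at-0 x₀≈e x₁≈e (suc n))) (*-identityˡ _))
                  (trans (-‿cong (trans (*-congʳ (trans (*-congˡ β0≈0) (zeroʳ _))) (zeroˡ _))) -0#≈0#))
          (+-identityʳ _)

  A0≈1 : ∀ n → A n 0 ≈ 1#
  A0≈1 = recurrence-at-0 refl τ0≈1

  B0≈0 : ∀ n → B n 0 ≈ 0#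
  B0≈0 = recurrence-at-0 refl β0≈0

  Ord≥-β : Ord≥ m β
  Ord≥-β = Ord≥-⊗ 0 m (λ _ ()) (Ord≥-z^ m)

  Ord≥-Y : Ord≥ m Y
  Ord≥-Y = Ord≥-cong (S.sym Y≋βf²) (Ord≥-mono (NP.m≤m+n m 0) (Ord≥-⊗ m 0 Ord≥-β (λ _ ())))

  Y0≈0 : Y 0 ≈ 0#
  Y0≈0 = Ord≥-Y 0 0<m

  Ord≥-μ^ : ∀ n → Ord≥ ((m N.+ m) N.* n) (μ^ n)
  Ord≥-μ^ zero    = Ord≥-mono (NP.≤-reflexive (NP.*-zeroʳ (m N.+ m))) (λ _ ())
  Ord≥-μ^ (suc n) = Ord≥-mono (NP.≤-reflexive (NP.*-suc (m N.+ m) n)) (Ord≥-⊗ (m N.+ m) _ (Ord≥-⊗ m m Ord≥-β Ord≥-Y) (Ord≥-μ^ n))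

  gap-end : ℕ → ℕ
  gap-end n = (m N.+ m) N.* n N.+ m

  Ord≥-E : ∀ n → Ord≥ (gap-end n) (E n)
  Ord≥-E n = Ord≥-⊗ _ m (Ord≥-μ^ n) Ord≥-Y

  Q : ℕ → Series
  Q n = W ⊗ A n

  Q0≈1 : ∀ n → Q n 0 ≈ 1#
  Q0≈1 n = trans (*-identityˡ _) (A0≈1 n)

  Deg≤-Q : ∀ n → Deg≤ (suc (m N.* n)) (Q n)
  Deg≤-Q n = Deg≤-⊗ 1 (m N.* n) Deg≤-W (Deg≤-A n)

  fQ≋approximation : ∀ n → f ⊗ Q n ≋ (A n ⊕ B n) ⊕ E n
  fQ≋approximation n = begin
    f ⊗ (W ⊗ A n)               ≈⟨ solve 3 (λ f w a → f :* (w :* a) := a :+ a :* (w :* f :- I)) S.refl f W (A n) ⟩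
    A n ⊕ A n ⊗ Y               ≈⟨ S.+-congˡ (approximation n) ⟩
    A n ⊕ (B n ⊕ E n)           ≈⟨ S.sym (S.+-assoc _ _ _) ⟩
    (A n ⊕ B n) ⊕ E n           ∎

  f-gap : ∀ n t → suc (m N.* n) ≤ t → t < gap-end n → conv f (Q n) t ≈ 0#
  f-gap n = coefficient-gap f (Q n) (A n ⊕ B n) (E n) (m N.* n) (gap-end n)
              (fQ≋approximation n) (Deg≤-⊕ (Deg≤-A n) (Deg≤-B n)) (Ord≥-E n)

  -- The second family: g = 1 / sqrt((1 - a z)² - 4 b z^m) satisfies
  -- g (1 - Y) = f, so it is annihilated in the same stretch of degrees by
  -- the polynomials (1 - a z)(A n - B n).
  module SquareRoot (no-2-torsion : ∀ x → x + x ≈ 0# → x ≈ 0#) (g : Series) (isG : PS.IsG R m a b g) where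
    module RS = IntegerSolver R
    open import Algebra.Properties.Group S.+-group using (x∙y⁻¹≈ε⇒x≈y)

    four : Series → Series
    four x = ((x ⊕ x) ⊕ x) ⊕ x

    Δ : Series
    Δ = W ⊗ W ⊕ ⊝ four β

    P≋Δ : PS.P R m a b ≋ Δ
    P≋Δ n = +-cong (conv≈⊗ W W n) (trans
      (RS.solve 2 (λ b x → RS.:- (((b RS.:+ b) RS.:+ b) RS.:+ b) RS.:* x RS.:=
                           RS.:- (((b RS.:* x RS.:+ b RS.:* x) RS.:+ b RS.:* x) RS.:+ b RS.:* x)) refl b ((z^ m) n))
      (-‿cong (sym (+-cong (+-cong (+-cong βn βn) βn) βn))))
      where
      βn : β n ≈ b * (z^ m) n
      βn = ⊗-constˡ b (z^ m) n

    g²Δ≋1 : (g ⊗ g) ⊗ Δ ≋ one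
    g²Δ≋1 n = trans (sym (⊗-cong (conv≈⊗ g g) P≋Δ n))
                    (trans (sym (conv≈⊗ (conv g g) (PS.P R m a b) n)) (proj₂ isG n))

    V : Series
    V = one ⊕ ⊝ Y

    -- f² Δ = (1 - Y)², after cancelling the unit (1 - a z)²
    f²Δ≋V² : (f ⊗ f) ⊗ Δ ≋ V ⊗ V
    f²Δ≋V² = ⊗-cancel-unit (W ⊗ W) _ _ (*-identityˡ 1#) (begin
      (W ⊗ W) ⊗ ((f ⊗ f) ⊗ Δ)
        ≈⟨ solve 3 (λ w f d → (w :* w) :* ((f :* f) :* d) := ((w :* f) :* (w :* f)) :* d) S.refl W f Δ ⟩
      ((W ⊗ f) ⊗ (W ⊗ f)) ⊗ Δ                                      ≈⟨ S.*-congʳ (S.*-cong Wf≋1+Y Wf≋1+Y) ⟩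
      ((one ⊕ Y) ⊗ (one ⊕ Y)) ⊗ Δ
        ≈⟨ solve 3 (λ w y β → ((I :+ y) :* (I :+ y)) :* (w :* w :- (((β :+ β) :+ β) :+ β)) :=
                             (w :* w) :* ((I :+ y) :* (I :+ y)) :- ((( β :* ((I :+ y) :* (I :+ y)) :+ β :* ((I :+ y) :* (I :+ y)))
                               :+ β :* ((I :+ y) :* (I :+ y))) :+ β :* ((I :+ y) :* (I :+ y))))
                 S.refl W Y β ⟩
      (W ⊗ W) ⊗ ((one ⊕ Y) ⊗ (one ⊕ Y)) ⊕ ⊝ four (β ⊗ ((one ⊕ Y) ⊗ (one ⊕ Y)))
        ≈⟨ S.+-congˡ (S.-‿cong (S.+-cong (S.+-cong (S.+-cong W²Y′ W²Y′) W²Y′) W²Y′)) ⟩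
      (W ⊗ W) ⊗ ((one ⊕ Y) ⊗ (one ⊕ Y)) ⊕ ⊝ four ((W ⊗ W) ⊗ Y)
        ≈⟨ solve 2 (λ w y → (w :* w) :* ((I :+ y) :* (I :+ y)) :- ((((w :* w) :* y :+ (w :* w) :* y) :+ (w :* w) :* y) :+ (w :* w) :* y) :=
                           (w :* w) :* ((I :- y) :* (I :- y))) S.refl W Y ⟩
      (W ⊗ W) ⊗ (V ⊗ V)                                            ∎)
      where
      W²Y′ = S.sym W²Y≋β[1+Y]²

    f²≋[gV]² : f ⊗ f ≋ (g ⊗ V) ⊗ (g ⊗ V)
    f²≋[gV]² = begin
      f ⊗ f                               ≈⟨ S.sym (S.*-identityʳ _) ⟩
      (f ⊗ f) ⊗ one                       ≈⟨ S.*-congˡ (S.sym g²Δ≋1) ⟩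
      (f ⊗ f) ⊗ ((g ⊗ g) ⊗ Δ)             ≈⟨ solve 3 (λ f g d → (f :* f) :* ((g :* g) :* d) := ((f :* f) :* d) :* (g :* g)) S.refl f g Δ ⟩
      ((f ⊗ f) ⊗ Δ) ⊗ (g ⊗ g)             ≈⟨ S.*-congʳ f²Δ≋V² ⟩
      (V ⊗ V) ⊗ (g ⊗ g)                   ≈⟨ solve 2 (λ v g → (v :* v) :* (g :* g) := (g :* v) :* (g :* v)) S.refl V g ⟩
      (g ⊗ V) ⊗ (g ⊗ V)                   ∎

    f0≈1 : f 0 ≈ 1#
    f0≈1 = trans (sym (*-identityˡ _)) (trans (Wf≋1+Y 0) (trans (+-congˡ Y0≈0) (+-identityʳ _)))

    V0≈1 : V 0 ≈ 1#
    V0≈1 = trans (+-congˡ (trans (-‿cong Y0≈0) -0#≈0#)) (+-identityʳ _)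

    -- the square root with constant term 1 is unique, since 2 is not a zero divisor
    gV≋f : g ⊗ V ≋ f
    gV≋f = S.sym (x∙y⁻¹≈ε⇒x≈y f (g ⊗ V) (cancel-two-zero no-2-torsion (f ⊕ ⊝ (g ⊗ V)) (f ⊕ g ⊗ V)
      (+-cong f0≈1 (trans (*-cong (proj₁ isG) V0≈1) (*-identityˡ 1#)))
      (S.trans (solve 2 (λ f h → (f :- h) :* (f :+ h) := f :* f :- h :* h) S.refl f (g ⊗ V)) (x≈y⇒x∙y⁻¹≈ε f²≋[gV]²))))

    Q′ : ℕ → Series
    Q′ n = W ⊗ (A n ⊕ ⊝ B n)

    Q′0≈1 : ∀ n → Q′ n 0 ≈ 1#
    Q′0≈1 n = trans (*-identityˡ _) (trans (+-cong (A0≈1 n) (trans (-‿cong (B0≈0 n)) -0#≈0#)) (+-identityʳ 1#))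

    Deg≤-Q′ : ∀ n → Deg≤ (suc (m N.* n)) (Q′ n)
    Deg≤-Q′ n = Deg≤-⊗ 1 (m N.* n) Deg≤-W (Deg≤-⊕ (Deg≤-A n) (Deg≤-⊝ (Deg≤-B n)))

    T : ℕ → Series
    T n = Q′ n ⊗ g ⊕ ⊝ (A n ⊕ B n)

    TV≋2E : ∀ n → T n ⊗ V ≋ E n ⊕ E n
    TV≋2E n = begin
      T n ⊗ V
        ≈⟨ solve 5 (λ w a b g v → ((w :* (a :- b)) :* g :- (a :+ b)) :* v := (w :* (a :- b)) :* (g :* v) :- (a :+ b) :* v)
                 S.refl W (A n) (B n) g V ⟩
      Q′ n ⊗ (g ⊗ V) ⊕ ⊝ ((A n ⊕ B n) ⊗ V)                   ≈⟨ S.+-congʳ (S.*-congˡ gV≋f) ⟩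
      Q′ n ⊗ f ⊕ ⊝ ((A n ⊕ B n) ⊗ V)
        ≈⟨ solve 4 (λ w a b f → (w :* (a :- b)) :* f :- (a :+ b) :* (I :- (w :* f :- I)) :=
                               (a :* (w :* f :- I) :- b) :+ (a :* (w :* f :- I) :- b)) S.refl W (A n) (B n) f ⟩
      (A n ⊗ Y ⊕ ⊝ B n) ⊕ (A n ⊗ Y ⊕ ⊝ B n)                  ≈⟨ S.+-cong (S.+-congʳ (approximation n)) (S.+-congʳ (approximation n)) ⟩
      ((B n ⊕ E n) ⊕ ⊝ B n) ⊕ ((B n ⊕ E n) ⊕ ⊝ B n)
        ≈⟨ solve 2 (λ b e → ((b :+ e) :- b) :+ ((b :+ e) :- b) := e :+ e) S.refl (B n) (E n) ⟩
      E n ⊕ E n                                               ∎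

    Ord≥-T : ∀ n → Ord≥ (gap-end n) (T n)
    Ord≥-T n = cancel-unit (gap-end n) (T n) V V0≈1 (Ord≥-cong (S.sym (TV≋2E n)) (Ord≥-⊕ (Ord≥-E n) (Ord≥-E n)))

    g-gap : ∀ n t → suc (m N.* n) ≤ t → t < gap-end n → conv g (Q′ n) t ≈ 0#
    g-gap n = coefficient-gap g (Q′ n) (A n ⊕ B n) (T n) (m N.* n) (gap-end n)
      (solve 3 (λ g q s → g :* q := s :+ (q :* g :- s)) S.refl g (Q′ n) (A n ⊕ B n))
      (Deg≤-⊕ (Deg≤-A n) (Deg≤-B n)) (Ord≥-T n)

theorem5p1 : ∀ {c ℓ : Level} (R : CommutativeRing c ℓ) → let open PS R in
    (∀ x → x + x ≈ 0# → x ≈ 0#) →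
    (m : ℕ) → 1 ≤ m → (a b : Carrier) → (cf g : Series) →
    IsF m a b cf → IsG m a b g → (n : ℕ) →
      ((∀ k → 2 ≤ k → k N.+ 1 ≤ m → det (hankel cf 0 (m N.* n N.+ k)) ≈ 0#) ×
       (∀ k → 2 ≤ k → k N.+ 2 ≤ m → det (hankel cf 1 (m N.* n N.+ k)) ≈ 0#) ×
       (∀ k → 2 ≤ k → k N.+ 3 ≤ m → det (hankel cf 2 (m N.* n N.+ k)) ≈ 0#)) ×
      ((∀ k → 2 ≤ k → k N.+ 1 ≤ m → det (hankel g 0 (m N.* n N.+ k)) ≈ 0#) ×
       (∀ k → 2 ≤ k → k N.+ 2 ≤ m → det (hankel g 1 (m N.* n N.+ k)) ≈ 0#) ×
       (∀ k → 2 ≤ k → k N.+ 3 ≤ m → det (hankel g 2 (m N.* n N.+ k)) ≈ 0#))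
theorem5p1 R no-2-torsion zero () a b f g isF isG n
theorem5p1 R no-2-torsion (suc zero) _ a b f g isF isG n = (no-k , no-k , no-k) , (no-k , no-k , no-k)
  where
  no-k : ∀ {p} {P : ℕ → Set p} {s} k → 2 ≤ k → k N.+ suc s ≤ 1 → P k
  no-k k (s≤s (s≤s _)) (s≤s ())
theorem5p1 R no-2-torsion m@(suc (suc _)) _ a b f g isF isG n =
  (f-family 0 , f-family 1 , f-family 2) , (g-family 0 , g-family 1 , g-family 2)
  where
  open CommutativeRing R using (_≈_; 0#)
  open PS R using (det; hankel)
  open Approximants R m (s≤s (s≤s z≤n)) a b f isF
  open SquareRoot no-2-torsion g isG
  open HankelCriterion R using (hankel-family)
  f-family : ∀ s k → 2 ≤ k → k N.+ suc s ≤ m → det (hankel f s (m N.* n N.+ k)) ≈ 0#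
  f-family = hankel-family f (Q n) m n (Q0≈1 n) (Deg≤-Q n) (f-gap n)
  g-family : ∀ s k → 2 ≤ k → k N.+ suc s ≤ m → det (hankel g s (m N.* n N.+ k)) ≈ 0#
  g-family = hankel-family g (Q′ n) m n (Q′0≈1 n) (Deg≤-Q′ n) (g-gap n)
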